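{- Let $\mathbb{F}$ be a field of characteristic zero with multiplicative identity $1_{\mathbb{F}}$. Let $\psi$ be the $\mathbb{F}$-linear functional on $\mathbb{F}[\alpha_1,\alpha_2]$ defined on monomials, for all $k,l\in\mathbb{N}$, by \[ \psi(\alpha_1^k\alpha_2^l)=\begin{cases}\Omega(m,n)\,1_{\mathbb{F}} & \text{if } k=2m \text{ and } l=2n,\\ 0 & \text{otherwise.}\end{cases} \] Then $\psi$ is a circular integral functional on $\mathbb{F}[\alpha_1,\alpha_2]$ with respect to $S^1$, and it is the only one.
   Context: $\mathbb{N}$ includes $0$. For $m,n\in\mathbb{N}$, $\Omega(m,n)=\dfrac{(2m)!(2n)!}{4^{m+n}\,m!\,n!\,(m+n)!}\in\mathbb{Q}$, and $a1_{\mathbb{F}}$ denotes the image of $a\in\mathbb{Q}$ in $\mathbb{F}$. Let $\mathbb{A}=\mathbb{F}^2$ (points $[x,y]$), $S^1=\{[x,y]\in\mathbb{A}: x^2+y^2=1_{\mathbb{F}}\}$, and let $\varepsilon$ be the evaluation map sending a polynomial to the function $\mathbb{A}\to\mathbb{F}$ it defines. $SO(2,\mathbb{F})$ is the group of $2\times 2$ matrices $h$ over $\mathbb{F}$ with $h^{ -1}=h^T$ and $\det h=1_{\mathbb{F}}$; it acts on $\mathbb{F}[\alpha_1,\alpha_2]$ by $h\cdot\pi(\alpha_1,\alpha_2)=\pi(h_{11}\alpha_1+h_{21}\alpha_2,\,h_{12}\alpha_1+h_{22}\alpha_2)$. A circular integral functional with respect to $S^1$ is an $\mathbb{F}$-linear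 map $\phi:\mathbb{F}[\alpha_1,\alpha_2]\to\mathbb{F}$ such that (Normalization) $\phi(\mathbf{1})=1_{\mathbb{F}}$ where $\mathbf{1}$ is the constant polynomial $1$; (Locality) $\phi(\pi)=0$ whenever $\varepsilon(\pi)$ vanishes at every point of $S^1$; (Invariance) $\phi(h\cdot\pi)=\phi(\pi)$ for all $\pi$ and all $h\in SO(2,\mathbb{F})$. -}

module Defs where

open import Level using (Level; _⊔_) renaming (suc to lsuc)
open import Algebra.Bundles using (CommutativeRing)
open import Relation.Nullary using (¬_)
open import Data.Nat as ℕ using (ℕ; zero; suc)
open import Data.Nat using (_!)
open import Data.List using (List; []; _∷_; _++_; map; foldr; concatMap)
open import Data.Product using (_×_; _,_)
open import Data.Maybe using (Maybe; just; nothing)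
import Data.Maybe as Maybe
open import Data.Fin using (Fin)
open import Data.Bool using (true; false)
import Data.Fin as Fin

-- Fields (agda-stdlib has no Field bundle): a commutative ring with
-- 1 ≠ 0 and an inverse operation that is a right inverse on nonzero
-- elements (the value of 0⁻¹ is irrelevant).

record Field (c ℓ : Level) : Set (lsuc (c ⊔ ℓ)) where
  field
    commutativeRing : CommutativeRing c ℓ
  open CommutativeRing commutativeRing public
  field
    _⁻¹        : Carrier → Carrier
    1≉0        : ¬ (1# ≈ 0#)
    ⁻¹-inverseʳ : ∀ x → ¬ (x ≈ 0#) → x * (x ⁻¹) ≈ 1#

module WithField {c ℓ : Level} (F : Field c ℓ) where
  open Field F hiding (zero)

  ℕ→F : ℕ → Carrier
  ℕ→F zero    = 0#
  ℕ→F (suc n) = 1# + ℕ→F n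

  CharZero : Set ℓ
  CharZero = ∀ n → ¬ (ℕ→F (suc n) ≈ 0#)

  -- Ω(m,n) · 1_F  =  (num · 1_F) (den · 1_F)⁻¹
  Ω-num Ω-den : ℕ → ℕ → ℕ
  Ω-num m n = ((2 ℕ.* m) !) ℕ.* ((2 ℕ.* n) !)
  Ω-den m n = (4 ℕ.^ (m ℕ.+ n)) ℕ.* (m !) ℕ.* (n !) ℕ.* ((m ℕ.+ n) !)

  ΩF : ℕ → ℕ → Carrier
  ΩF m n = ℕ→F (Ω-num m n) * (ℕ→F (Ω-den m n)) ⁻¹

  _^F_ : Carrier → ℕ → Carrier
  x ^F zero  = 1#
  x ^F suc n = x * (x ^F n)

  sumF : List Carrier → Carrier
  sumF = foldr _+_ 0#

  -- F[α₁,α₂]: a polynomial is a finite formal sum of terms  a α₁^k α₂^l,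
  -- represented by a list of (a , k , l); two such are the same
  -- polynomial iff all their coefficients agree (setoid _≈ₚ_).

  Term : Set c
  Term = Carrier × ℕ × ℕ

  Poly : Set c
  Poly = List Term

  coeffTerm : ℕ → ℕ → Term → Carrier
  coeffTerm k l (a , i , j) with k ℕ.≡ᵇ i | l ℕ.≡ᵇ j
  ... | true | true = a
  ... | _ | _ = 0#


  coeff : Poly → ℕ → ℕ → Carrier
  coeff p k l = sumF (map (coeffTerm k l) p)

  _≈ₚ_ : Poly → Poly → Set ℓ
  p ≈ₚ q = ∀ k l → coeff p k l ≈ coeff q k l

  _+ₚ_ : Poly → Poly → Poly
  _+ₚ_ = _++_

  _·ₚ_ : Carrier → Poly → Poly
  a ·ₚ p = map (λ { (b , k , l) → (a * b , k , l) }) p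

  _*ₚ_ : Poly → Poly → Poly
  p *ₚ q = concatMap (λ { (a , i , j) →
             map (λ { (b , k , l) → (a * b , i ℕ.+ k , j ℕ.+ l) }) q }) p

  𝟏 : Poly
  𝟏 = (1# , 0 , 0) ∷ []

  _^ₚ_ : Poly → ℕ → Poly
  p ^ₚ zero  = 𝟏
  p ^ₚ suc n = p *ₚ (p ^ₚ n)

  ε : Poly → Carrier → Carrier → Carrier
  ε p x y = sumF (map (λ { (a , k , l) → a * ((x ^F k) * (y ^F l)) }) p)

  subst : Poly → Poly → Poly → Poly
  subst p L₁ L₂ = foldr (λ { (a , k , l) acc →
                     (a ·ₚ ((L₁ ^ₚ k) *ₚ (L₂ ^ₚ l))) +ₚ acc }) [] p

  linForm : Carrier → Carrier → Poly
  linForm a b = (a , 1 , 0) ∷ (b , 0 , 1) ∷ []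

  Mat : Set c
  Mat = Fin 2 → Fin 2 → Carrier

  i₁ i₂ : Fin 2
  i₁ = Fin.zero
  i₂ = Fin.suc Fin.zero

  transpose : Mat → Mat
  transpose h i j = h j i

  _⊗_ : Mat → Mat → Mat
  (g ⊗ h) i j = (g i i₁ * h i₁ j) + (g i i₂ * h i₂ j)

  I₂ : Mat
  I₂ Fin.zero    Fin.zero    = 1#
  I₂ (Fin.suc _) (Fin.suc _) = 1#
  I₂ Fin.zero    (Fin.suc _) = 0#
  I₂ (Fin.suc _) Fin.zero    = 0#

  _≈ₘ_ : Mat → Mat → Set ℓ
  g ≈ₘ h = ∀ i j → g i j ≈ h i j

  det : Mat → Carrier
  det h = (h i₁ i₁ * h i₂ i₂) - (h i₁ i₂ * h i₂ i₁)

  record InSO2 (h : Mat) : Set ℓ where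
    field
      inv-right : (h ⊗ transpose h) ≈ₘ I₂
      inv-left  : (transpose h ⊗ h) ≈ₘ I₂
      det-one   : det h ≈ 1#

  act : Mat → Poly → Poly
  act h p = subst p (linForm (h i₁ i₁) (h i₂ i₁)) (linForm (h i₁ i₂) (h i₂ i₂))

  record IsLinear (φ : Poly → Carrier) : Set (c ⊔ ℓ) where
    field
      φ-cong  : ∀ p q → p ≈ₚ q → φ p ≈ φ q
      φ-+     : ∀ p q → φ (p +ₚ q) ≈ φ p + φ q
      φ-scale : ∀ a p → φ (a ·ₚ p) ≈ a * φ p

  record IsCircularIntegral (φ : Poly → Carrier) : Set (c ⊔ ℓ) where
    field
      linear        : IsLinear φ
      normalization : φ 𝟏 ≈ 1#
      locality      : ∀ p → (∀ x y → (x * x) + (y * y) ≈ 1# → ε p x y ≈ 0#)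
                          → φ p ≈ 0#
      invariance    : ∀ h → InSO2 h → ∀ p → φ (act h p) ≈ φ p

  half : ℕ → Maybe ℕ
  half zero          = just zero
  half (suc zero)    = nothing
  half (suc (suc n)) = Maybe.map suc (half n)

  ψ-mono : ℕ → ℕ → Carrier
  ψ-mono k l with half k | half l
  ... | just m | just n = ΩF m n
  ... | _      | _      = 0#

  ψ : Poly → Carrier
  ψ p = sumF (map (λ { (a , k , l) → a * ψ-mono k l }) p)

{-# OPTIONS --safe #-}
module Submission where

-- ψ is the mean over the circle: Ω(m , n) is the average of cos²ᵐ θ sin²ⁿ θ.
--
-- Uniqueness. On S¹ a monomial times a harmonic Re (α₁ + i α₂)ʲ or
-- Im (α₁ + i α₂)ʲ is, by the three-term recurrences, a combination of
-- harmonics, so a local normalised linear functional is determined by its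
-- values on the nonconstant harmonics. A circular integral vanishes there: the
-- rotation by arg (3 + 4i) has infinite order, since (3 + 4i)ʲ ≡ 3 + 4i mod 5,
-- and it rotates the pair of j-th harmonics by j times that angle.
--
-- Existence. The weights satisfy Ω(m , n) = Ω(m + 1 , n) + Ω(m , n + 1), so ψ
-- only sees the reduction of a polynomial modulo α₁² + α₂² − 1 to the form
-- A(α₁) + α₂ B(α₁); if the polynomial vanishes on S¹ then A vanishes at the
-- infinitely many rational points of S¹, so ψ is local. ψ is killed by the
-- rotation field α₂ ∂₁ − α₁ ∂₂, which multiplies (α₁ + i α₂)ʲ by −i j, so ψ
-- vanishes on the nonconstant harmonics; then ψ ∘ h has the same properties
-- for h ∈ SO(2), and by uniqueness ψ ∘ h = ψ.

open import Defs
open import Level using (Level; _⊔_; Lift; lift)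
open import Data.Nat as ℕ using (ℕ; zero; suc; _!; NonZero)
import Data.Nat.Properties as ℕP
open import Data.Nat.DivMod using (_%_; [m+kn]%n≡m%n; m*n%n≡0)
open import Data.Nat.Tactic.RingSolver using (solve-∀)
open import Data.Product using (_×_; _,_; proj₁; proj₂)
open import Data.Sum using (inj₁; inj₂)
open import Data.List using (List; []; _∷_; _++_; map; length)
import Data.List.Properties as List
open import Data.List.Relation.Unary.All using (All; []; _∷_)
open import Data.Maybe using (Maybe; just; nothing)
import Data.Maybe as Maybe
open import Data.Bool using (true; false; T)
open import Data.Empty using (⊥-elim)
import Data.Fin as Fin
open import Relation.Nullary using (¬_; yes; no)
open import Relation.Binary.Definitions using (tri<; tri≈; tri>)
open import Relation.Binary.PropositionalEquality as ≡ using (_≡_; _≢_)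
open import Algebra.Bundles using (RawRing)
open import Algebra.Solver.Ring.AlmostCommutativeRing
  using (fromCommutativeRing; _-Raw-AlmostCommutative⟶_)

m∸n+n≡m+[n∸m] : ∀ m n → (m ℕ.∸ n) ℕ.+ n ≡ m ℕ.+ (n ℕ.∸ m)
m∸n+n≡m+[n∸m] zero    zero    = ≡.refl
m∸n+n≡m+[n∸m] zero    (suc n) = ≡.refl
m∸n+n≡m+[n∸m] (suc m) zero    = ≡.refl
m∸n+n≡m+[n∸m] (suc m) (suc n) =
  ≡.trans (ℕP.+-suc (m ℕ.∸ n) n) (≡.cong suc (m∸n+n≡m+[n∸m] m n))

5a+3≢5b+5c : ∀ a b c → 5 ℕ.* a ℕ.+ 3 ≢ 5 ℕ.* b ℕ.+ 5 ℕ.* c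
5a+3≢5b+5c a b c eq = 3≢0 (begin
  3                      ≡⟨ ≡.sym ([m+kn]%n≡m%n 3 a 5) ⟩
  (3 ℕ.+ a ℕ.* 5) % 5    ≡⟨ ≡.cong (_% 5) (rearranged a b c eq) ⟩
  ((b ℕ.+ c) ℕ.* 5) % 5  ≡⟨ m*n%n≡0 (b ℕ.+ c) 5 ⟩
  0                      ∎)
  where
  open ≡.≡-Reasoning
  3≢0 : 3 ≢ 0
  3≢0 ()
  rearranged : ∀ a b c → 5 ℕ.* a ℕ.+ 3 ≡ 5 ℕ.* b ℕ.+ 5 ℕ.* c → 3 ℕ.+ a ℕ.* 5 ≡ (b ℕ.+ c) ℕ.* 5
  rearranged a b c eq = ≡.trans (lhs a) (≡.trans eq (rhs b c))
    where
    lhs : ∀ a → 3 ℕ.+ a ℕ.* 5 ≡ 5 ℕ.* a ℕ.+ 3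
    lhs = solve-∀
    rhs : ∀ b c → 5 ℕ.* b ℕ.+ 5 ℕ.* c ≡ (b ℕ.+ c) ℕ.* 5
    rhs = solve-∀

-- Integer coefficients for the ring solver: (a , b) stands for a − b, and
-- the operations normalise, so that closed coefficients compute to a
-- canonical form and the solver can compare them by refl.
Diff : Set
Diff = ℕ × ℕ

normalise : ℕ → ℕ → Diff
normalise a b = (a ℕ.∸ b , b ℕ.∸ a)

Diff-rawRing : RawRing Level.zero Level.zero
Diff-rawRing = record
  { Carrier = Diff
  ; _≈_     = _≡_
  ; _+_     = λ { (a , b) (c , d) → normalise (a ℕ.+ c) (b ℕ.+ d) }
  ; _*_     = λ { (a , b) (c , d) → normalise (a ℕ.* c ℕ.+ b ℕ.* d) (a ℕ.* d ℕ.+ b ℕ.* c) }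
  ; -_      = λ { (a , b) → (b , a) }
  ; 0#      = (0 , 0)
  ; 1#      = (1 , 0)
  }

module AnyField {c ℓ : Level} (F : Field c ℓ) where
  open Field F hiding (zero)
  open WithField F
  open import Relation.Binary.Reasoning.Setoid setoid
  open import Algebra.Properties.Ring ring
    using (-0#≈0#; -‿+-comm; -‿involutive; -‿distribˡ-*; -‿distribʳ-*)

  ℕ→F-+ : ∀ m n → ℕ→F (m ℕ.+ n) ≈ ℕ→F m + ℕ→F n
  ℕ→F-+ zero    n = sym (+-identityˡ _)
  ℕ→F-+ (suc m) n = trans (+-congˡ (ℕ→F-+ m n)) (sym (+-assoc _ _ _))

  ℕ→F-* : ∀ m n → ℕ→F (m ℕ.* n) ≈ ℕ→F m * ℕ→F n
  ℕ→F-* zero    n = sym (zeroˡ _)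
  ℕ→F-* (suc m) n = begin
    ℕ→F (n ℕ.+ m ℕ.* n)           ≈⟨ trans (ℕ→F-+ n (m ℕ.* n)) (+-congˡ (ℕ→F-* m n)) ⟩
    ℕ→F n + ℕ→F m * ℕ→F n         ≈⟨ +-congʳ (sym (*-identityˡ (ℕ→F n))) ⟩
    1# * ℕ→F n + ℕ→F m * ℕ→F n    ≈⟨ sym (distribʳ (ℕ→F n) 1# (ℕ→F m)) ⟩
    (1# + ℕ→F m) * ℕ→F n          ∎

  x-y≈x+z-[y+z] : ∀ x y z → x - y ≈ (x + z) - (y + z)
  x-y≈x+z-[y+z] x y z = begin
    x - y                     ≈⟨ sym (+-identityʳ _) ⟩
    (x - y) + 0#              ≈⟨ +-congˡ (sym (-‿inverseʳ z)) ⟩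
    (x - y) + (z - z)         ≈⟨ +-assoc x (- y) (z - z) ⟩
    x + (- y + (z - z))       ≈⟨ +-congˡ (sym (+-assoc (- y) z (- z))) ⟩
    x + ((- y + z) - z)       ≈⟨ +-congˡ (+-congʳ (+-comm (- y) z)) ⟩
    x + ((z - y) - z)         ≈⟨ +-congˡ (+-assoc z (- y) (- z)) ⟩
    x + (z + (- y - z))       ≈⟨ sym (+-assoc x z _) ⟩
    (x + z) + (- y - z)       ≈⟨ +-congˡ (-‿+-comm y z) ⟩
    (x + z) - (y + z)         ∎

  ℕ→F-difference : ∀ a b c d → a ℕ.+ d ≡ c ℕ.+ b → ℕ→F a - ℕ→F b ≈ ℕ→F c - ℕ→F d
  ℕ→F-difference a b c d a+d≡c+b = begin
    ℕ→F a - ℕ→F b                       ≈⟨ x-y≈x+z-[y+z] (ℕ→F a) (ℕ→F b) (ℕ→F d) ⟩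
    (ℕ→F a + ℕ→F d) - (ℕ→F b + ℕ→F d)   ≈⟨ +-congʳ (sym (ℕ→F-+ a d)) ⟩
    ℕ→F (a ℕ.+ d) - (ℕ→F b + ℕ→F d)     ≡⟨ ≡.cong (λ n → ℕ→F n - (ℕ→F b + ℕ→F d)) a+d≡c+b ⟩
    ℕ→F (c ℕ.+ b) - (ℕ→F b + ℕ→F d)     ≈⟨ +-congʳ (trans (ℕ→F-+ c b) (+-comm (ℕ→F c) (ℕ→F b))) ⟩
    (ℕ→F b + ℕ→F c) - (ℕ→F b + ℕ→F d)   ≈⟨ +-cong (+-comm _ _) (-‿cong (+-comm _ _)) ⟩
    (ℕ→F c + ℕ→F b) - (ℕ→F d + ℕ→F b)   ≈⟨ sym (x-y≈x+z-[y+z] (ℕ→F c) (ℕ→F d) (ℕ→F b)) ⟩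
    ℕ→F c - ℕ→F d                       ∎

  -- Agrees with ℕ→F, but sends 1 to 1# on the nose, so that the solver
  -- constant K n below denotes lit n (K 1 is 1#, K 2 is 1# + 1#, ...).
  lit : ℕ → Carrier
  lit zero          = 0#
  lit (suc zero)    = 1#
  lit (suc (suc n)) = 1# + lit (suc n)

  lit≈ℕ→F : ∀ n → lit n ≈ ℕ→F n
  lit≈ℕ→F zero          = refl
  lit≈ℕ→F (suc zero)    = sym (+-identityʳ 1#)
  lit≈ℕ→F (suc (suc n)) = +-congˡ (lit≈ℕ→F (suc n))

  ⟦_⟧ᵈ : Diff → Carrier
  ⟦ (a , zero) ⟧ᵈ        = lit a
  ⟦ (zero , suc b) ⟧ᵈ    = - lit (suc b)
  ⟦ (suc a , suc b) ⟧ᵈ   = lit (suc a) - lit (suc b)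

  ⟦⟧ᵈ-correct : ∀ a b → ⟦ (a , b) ⟧ᵈ ≈ ℕ→F a - ℕ→F b
  ⟦⟧ᵈ-correct a       zero    =
    trans (lit≈ℕ→F a) (trans (sym (+-identityʳ (ℕ→F a))) (+-congˡ (sym -0#≈0#)))
  ⟦⟧ᵈ-correct zero    (suc b) = trans (-‿cong (lit≈ℕ→F (suc b))) (sym (+-identityˡ _))
  ⟦⟧ᵈ-correct (suc a) (suc b) = +-cong (lit≈ℕ→F (suc a)) (-‿cong (lit≈ℕ→F (suc b)))

  ⟦normalise⟧ : ∀ a b → ⟦ normalise a b ⟧ᵈ ≈ ℕ→F a - ℕ→F b
  ⟦normalise⟧ a b = trans (⟦⟧ᵈ-correct (a ℕ.∸ b) (b ℕ.∸ a))
    (ℕ→F-difference (a ℕ.∸ b) (b ℕ.∸ a) a b (m∸n+n≡m+[n∸m] a b))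

  private
    [x+y]+[z+w]≈[x+z]+[y+w] : ∀ x y z w → (x + y) + (z + w) ≈ (x + z) + (y + w)
    [x+y]+[z+w]≈[x+z]+[y+w] x y z w = begin
      (x + y) + (z + w) ≈⟨ +-assoc x y (z + w) ⟩
      x + (y + (z + w)) ≈⟨ +-congˡ (sym (+-assoc y z w)) ⟩
      x + ((y + z) + w) ≈⟨ +-congˡ (+-congʳ (+-comm y z)) ⟩
      x + ((z + y) + w) ≈⟨ +-congˡ (+-assoc z y w) ⟩
      x + (z + (y + w)) ≈⟨ sym (+-assoc x z (y + w)) ⟩
      (x + z) + (y + w) ∎

    difference-+ : ∀ x y z w → (x + z) - (y + w) ≈ (x - y) + (z - w)
    difference-+ x y z w = begin
      (x + z) - (y + w)     ≈⟨ +-congˡ (sym (-‿+-comm y w)) ⟩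
      (x + z) + (- y - w)   ≈⟨ [x+y]+[z+w]≈[x+z]+[y+w] x z (- y) (- w) ⟩
      (x - y) + (z - w)     ∎

    difference-* : ∀ x y z w → (x * z + y * w) - (x * w + y * z) ≈ (x - y) * (z - w)
    difference-* x y z w = sym (begin
      (x - y) * (z - w)
        ≈⟨ trans (distribʳ (z - w) x (- y)) (+-cong (distribˡ x z (- w)) (distribˡ (- y) z (- w))) ⟩
      (x * z + x * (- w)) + ((- y) * z + (- y) * (- w))
        ≈⟨ +-cong (+-congˡ (sym (-‿distribʳ-* x w)))
                  (+-cong (sym (-‿distribˡ-* y z)) minus-minus) ⟩
      (x * z - x * w) + (- (y * z) + y * w)
        ≈⟨ +-congˡ (+-comm _ _) ⟩
      (x * z - x * w) + (y * w - y * z)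
        ≈⟨ sym (difference-+ (x * z) (x * w) (y * w) (y * z)) ⟩
      (x * z + y * w) - (x * w + y * z) ∎)
      where
      minus-minus : (- y) * (- w) ≈ y * w
      minus-minus = trans (sym (-‿distribˡ-* y (- w)))
        (trans (-‿cong (sym (-‿distribʳ-* y w))) (-‿involutive (y * w)))

  Diff-homomorphism : Diff-rawRing -Raw-AlmostCommutative⟶ fromCommutativeRing commutativeRing
  Diff-homomorphism = record
    { ⟦_⟧    = ⟦_⟧ᵈ
    ; +-homo = λ { (a , b) (c , d) → begin
        ⟦ normalise (a ℕ.+ c) (b ℕ.+ d) ⟧ᵈ
          ≈⟨ ⟦normalise⟧ (a ℕ.+ c) (b ℕ.+ d) ⟩
        ℕ→F (a ℕ.+ c) - ℕ→F (b ℕ.+ d)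
          ≈⟨ +-cong (ℕ→F-+ a c) (-‿cong (ℕ→F-+ b d)) ⟩
        (ℕ→F a + ℕ→F c) - (ℕ→F b + ℕ→F d)
          ≈⟨ difference-+ (ℕ→F a) (ℕ→F b) (ℕ→F c) (ℕ→F d) ⟩
        (ℕ→F a - ℕ→F b) + (ℕ→F c - ℕ→F d)
          ≈⟨ sym (+-cong (⟦⟧ᵈ-correct a b) (⟦⟧ᵈ-correct c d)) ⟩
        ⟦ (a , b) ⟧ᵈ + ⟦ (c , d) ⟧ᵈ ∎ }
    ; *-homo = λ { (a , b) (c , d) → begin
        ⟦ normalise (a ℕ.* c ℕ.+ b ℕ.* d) (a ℕ.* d ℕ.+ b ℕ.* c) ⟧ᵈ
          ≈⟨ ⟦normalise⟧ (a ℕ.* c ℕ.+ b ℕ.* d) (a ℕ.* d ℕ.+ b ℕ.* c) ⟩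
        ℕ→F (a ℕ.* c ℕ.+ b ℕ.* d) - ℕ→F (a ℕ.* d ℕ.+ b ℕ.* c)
          ≈⟨ +-cong (ℕ→F-+* a c b d) (-‿cong (ℕ→F-+* a d b c)) ⟩
        (ℕ→F a * ℕ→F c + ℕ→F b * ℕ→F d) - (ℕ→F a * ℕ→F d + ℕ→F b * ℕ→F c)
          ≈⟨ difference-* (ℕ→F a) (ℕ→F b) (ℕ→F c) (ℕ→F d) ⟩
        (ℕ→F a - ℕ→F b) * (ℕ→F c - ℕ→F d)
          ≈⟨ sym (*-cong (⟦⟧ᵈ-correct a b) (⟦⟧ᵈ-correct c d)) ⟩
        ⟦ (a , b) ⟧ᵈ * ⟦ (c , d) ⟧ᵈ ∎ }
    ; -‿homo = λ { (a , b) → begin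
        ⟦ (b , a) ⟧ᵈ               ≈⟨ ⟦⟧ᵈ-correct b a ⟩
        ℕ→F b - ℕ→F a             ≈⟨ +-comm (ℕ→F b) (- ℕ→F a) ⟩
        - ℕ→F a + ℕ→F b           ≈⟨ +-congˡ (sym (-‿involutive (ℕ→F b))) ⟩
        - ℕ→F a + - - ℕ→F b       ≈⟨ -‿+-comm (ℕ→F a) (- ℕ→F b) ⟩
        - (ℕ→F a - ℕ→F b)         ≈⟨ -‿cong (sym (⟦⟧ᵈ-correct a b)) ⟩
        - ⟦ (a , b) ⟧ᵈ             ∎ }
    ; 0-homo = refl
    ; 1-homo = refl
    }
    where
    ℕ→F-+* : ∀ a c b d → ℕ→F (a ℕ.* c ℕ.+ b ℕ.* d) ≈ ℕ→F a * ℕ→F c + ℕ→F b * ℕ→F d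
    ℕ→F-+* a c b d = trans (ℕ→F-+ (a ℕ.* c) (b ℕ.* d)) (+-cong (ℕ→F-* a c) (ℕ→F-* b d))

  Diff-equal? : ∀ x y → Maybe (⟦ x ⟧ᵈ ≈ ⟦ y ⟧ᵈ)
  Diff-equal? (a , b) (c , d) with (a ℕ.+ d) ℕP.≟ (c ℕ.+ b)
  ... | yes a+d≡c+b = just (trans (⟦⟧ᵈ-correct a b)
                              (trans (ℕ→F-difference a b c d a+d≡c+b) (sym (⟦⟧ᵈ-correct c d))))
  ... | no _        = nothing

  open import Algebra.Solver.Ring Diff-rawRing (fromCommutativeRing commutativeRing)
    Diff-homomorphism Diff-equal? public
    using (solve; _:=_; _:+_; _:*_; :-_; _:-_; con; Polynomial)

  K : ∀ {n} → ℕ → Polynomial n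
  K n = con (n , 0)

  x≈x+y⇒y≈0 : ∀ x y → x ≈ x + y → y ≈ 0#
  x≈x+y⇒y≈0 x y x≈x+y = begin
    y                 ≈⟨ solve 2 (λ x y → y := (x :+ y) :- x) refl x y ⟩
    (x + y) - x       ≈⟨ +-congʳ (sym x≈x+y) ⟩
    x - x             ≈⟨ -‿inverseʳ x ⟩
    0#                ∎

  *-cancelˡ : ∀ a {x y} → ¬ (a ≈ 0#) → a * x ≈ a * y → x ≈ y
  *-cancelˡ a {x} {y} a≉0 ax≈ay = begin
    x                      ≈⟨ sym (*-identityˡ x) ⟩
    1# * x                 ≈⟨ *-congʳ (sym (⁻¹-inverseʳ a a≉0)) ⟩
    (a * a ⁻¹) * x         ≈⟨ solve 3 (λ a x i → (a :* i) :* x := i :* (a :* x)) refl a x (a ⁻¹) ⟩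
    a ⁻¹ * (a * x)         ≈⟨ *-congˡ ax≈ay ⟩
    a ⁻¹ * (a * y)         ≈⟨ solve 3 (λ a y i → i :* (a :* y) := (a :* i) :* y) refl a y (a ⁻¹) ⟩
    (a * a ⁻¹) * y         ≈⟨ *-congʳ (⁻¹-inverseʳ a a≉0) ⟩
    1# * y                 ≈⟨ *-identityˡ y ⟩
    y                      ∎

  a*x≈0⇒x≈0 : ∀ a {x} → ¬ (a ≈ 0#) → a * x ≈ 0# → x ≈ 0#
  a*x≈0⇒x≈0 a {x} a≉0 ax≈0 = *-cancelˡ a a≉0 (trans ax≈0 (sym (zeroʳ a)))

  ^F-+ : ∀ x i k → x ^F (i ℕ.+ k) ≈ (x ^F i) * (x ^F k)
  ^F-+ x zero    k = sym (*-identityˡ _)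
  ^F-+ x (suc i) k = trans (*-congˡ (^F-+ x i k)) (sym (*-assoc _ _ _))

  ^F-cong : ∀ {x y} n → x ≈ y → x ^F n ≈ y ^F n
  ^F-cong zero    x≈y = refl
  ^F-cong (suc n) x≈y = *-cong x≈y (^F-cong n x≈y)

  Weights : Set c
  Weights = ℕ → ℕ → Carrier

  extend : Weights → Poly → Carrier
  extend g []              = 0#
  extend g ((a , k , l) ∷ p) = a * g k l + extend g p

  extend-++ : ∀ g p q → extend g (p ++ q) ≈ extend g p + extend g q
  extend-++ g []      q = sym (+-identityˡ _)
  extend-++ g (t ∷ p) q = trans (+-congˡ (extend-++ g p q)) (sym (+-assoc _ _ _))

  extend-·ₚ : ∀ g a p → extend g (a ·ₚ p) ≈ a * extend g p
  extend-·ₚ g a []                = sym (zeroʳ a)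
  extend-·ₚ g a ((b , k , l) ∷ p) =
    trans (+-cong (*-assoc a b (g k l)) (extend-·ₚ g a p)) (sym (distribˡ a _ _))

  extend-cong : ∀ {g h} → (∀ k l → g k l ≈ h k l) → ∀ p → extend g p ≈ extend h p
  extend-cong g≈h []                = refl
  extend-cong g≈h ((a , k , l) ∷ p) = +-cong (*-congˡ (g≈h k l)) (extend-cong g≈h p)

  extend-+ : ∀ g h p → extend (λ k l → g k l + h k l) p ≈ extend g p + extend h p
  extend-+ g h []                = sym (+-identityˡ 0#)
  extend-+ g h ((a , k , l) ∷ p) =
    trans (+-cong (distribˡ a (g k l) (h k l)) (extend-+ g h p))
      (solve 4 (λ x y z w → (x :+ y) :+ (z :+ w) := (x :+ z) :+ (y :+ w)) refl _ _ _ _)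

  extend-* : ∀ g b p → extend (λ k l → b * g k l) p ≈ b * extend g p
  extend-* g b []                = sym (zeroʳ b)
  extend-* g b ((a , k , l) ∷ p) =
    trans (+-cong (solve 3 (λ a b x → a :* (b :* x) := b :* (a :* x)) refl a b (g k l))
                  (extend-* g b p))
      (sym (distribˡ b _ _))

  extend-zero : ∀ {g} → (∀ k l → g k l ≈ 0#) → ∀ p → extend g p ≈ 0#
  extend-zero g≈0 []                = refl
  extend-zero g≈0 ((a , k , l) ∷ p) =
    trans (+-cong (trans (*-congˡ (g≈0 k l)) (zeroʳ a)) (extend-zero g≈0 p)) (+-identityˡ 0#)

  shift : ℕ → ℕ → Weights → Weights
  shift i j g k l = g (i ℕ.+ k) (j ℕ.+ l)

  extend-term-*ₚ : ∀ g a i j q → extend g (((a , i , j) ∷ []) *ₚ q) ≈ a * extend (shift i j g) q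
  extend-term-*ₚ g a i j []                = sym (zeroʳ a)
  extend-term-*ₚ g a i j ((b , k , l) ∷ q) =
    trans (+-cong (*-assoc a b _) (extend-term-*ₚ g a i j q)) (sym (distribˡ a _ _))

  *ₚ-∷ : ∀ t p q → (t ∷ p) *ₚ q ≡ ((t ∷ []) *ₚ q) ++ (p *ₚ q)
  *ₚ-∷ t p q = ≡.sym (≡.cong (_++ (p *ₚ q)) (List.++-identityʳ _))

  extend-*ₚ : ∀ g p q → extend g (p *ₚ q) ≈ extend (λ i j → extend (shift i j g) q) p
  extend-*ₚ g []        q = refl
  extend-*ₚ g ((a , i , j) ∷ p) q = begin
    extend g (((a , i , j) ∷ p) *ₚ q)
      ≡⟨ ≡.cong (extend g) (*ₚ-∷ (a , i , j) p q) ⟩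
    extend g ((((a , i , j) ∷ []) *ₚ q) ++ (p *ₚ q))
      ≈⟨ extend-++ g (((a , i , j) ∷ []) *ₚ q) (p *ₚ q) ⟩
    extend g (((a , i , j) ∷ []) *ₚ q) + extend g (p *ₚ q)
      ≈⟨ +-cong (extend-term-*ₚ g a i j q) (extend-*ₚ g p q) ⟩
    a * extend (shift i j g) q + extend (λ i j → extend (shift i j g) q) p ∎

  ψ≡extend : ∀ p → ψ p ≡ extend ψ-mono p
  ψ≡extend []                = ≡.refl
  ψ≡extend ((a , k , l) ∷ p) = ≡.cong (a * ψ-mono k l +_) (ψ≡extend p)

  monomialAt : Carrier → Carrier → Weights
  monomialAt x y k l = (x ^F k) * (y ^F l)

  ε≡extend : ∀ p x y → ε p x y ≡ extend (monomialAt x y) p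
  ε≡extend []                x y = ≡.refl
  ε≡extend ((a , k , l) ∷ p) x y = ≡.cong (a * monomialAt x y k l +_) (ε≡extend p x y)

  ε-++ : ∀ p q x y → ε (p ++ q) x y ≈ ε p x y + ε q x y
  ε-++ p q x y rewrite ε≡extend (p ++ q) x y | ε≡extend p x y | ε≡extend q x y =
    extend-++ (monomialAt x y) p q

  ε-·ₚ : ∀ a p x y → ε (a ·ₚ p) x y ≈ a * ε p x y
  ε-·ₚ a p x y rewrite ε≡extend (a ·ₚ p) x y | ε≡extend p x y = extend-·ₚ (monomialAt x y) a p

  ε-*ₚ : ∀ p q x y → ε (p *ₚ q) x y ≈ ε p x y * ε q x y
  ε-*ₚ p q x y rewrite ε≡extend (p *ₚ q) x y | ε≡extend p x y | ε≡extend q x y = begin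
    extend m (p *ₚ q)                              ≈⟨ extend-*ₚ m p q ⟩
    extend (λ i j → extend (shift i j m) q) p     ≈⟨ extend-cong (λ i j → shifted i j) p ⟩
    extend (λ i j → extend m q * m i j) p         ≈⟨ extend-* m (extend m q) p ⟩
    extend m q * extend m p                        ≈⟨ *-comm _ _ ⟩
    extend m p * extend m q                        ∎
    where
    m = monomialAt x y
    shifted : ∀ i j → extend (shift i j m) q ≈ extend m q * m i j
    shifted i j = begin
      extend (shift i j m) q               ≈⟨ extend-cong (λ k l → *-cong (^F-+ x i k) (^F-+ y j l)) q ⟩
      extend (λ k l → ((x ^F i) * (x ^F k)) * ((y ^F j) * (y ^F l))) q
        ≈⟨ extend-cong (λ k l → solve 4 (λ a b c d → (a :* b) :* (c :* d) := (a :* c) :* (b :* d))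
                                   refl (x ^F i) (x ^F k) (y ^F j) (y ^F l)) q ⟩
      extend (λ k l → m i j * m k l) q     ≈⟨ extend-* m (m i j) q ⟩
      m i j * extend m q                   ≈⟨ *-comm _ _ ⟩
      extend m q * m i j                   ∎

  ε-𝟏 : ∀ x y → ε 𝟏 x y ≈ 1#
  ε-𝟏 x y = trans (+-identityʳ _) (trans (*-identityˡ _) (*-identityˡ _))

  ε-^ₚ : ∀ L n x y → ε (L ^ₚ n) x y ≈ ε L x y ^F n
  ε-^ₚ L zero    x y = ε-𝟏 x y
  ε-^ₚ L (suc n) x y = trans (ε-*ₚ L (L ^ₚ n) x y) (*-congˡ (ε-^ₚ L n x y))

  ε-subst : ∀ p L₁ L₂ x y → ε (subst p L₁ L₂) x y ≈ ε p (ε L₁ x y) (ε L₂ x y)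
  ε-subst []                L₁ L₂ x y = refl
  ε-subst ((a , i , j) ∷ p) L₁ L₂ x y = begin
    ε ((a ·ₚ M) ++ subst p L₁ L₂) x y          ≈⟨ ε-++ (a ·ₚ M) (subst p L₁ L₂) x y ⟩
    ε (a ·ₚ M) x y + ε (subst p L₁ L₂) x y     ≈⟨ +-cong (ε-·ₚ a M x y) (ε-subst p L₁ L₂ x y) ⟩
    a * ε M x y + ε p (ε L₁ x y) (ε L₂ x y)
      ≈⟨ +-congʳ (*-congˡ (trans (ε-*ₚ (L₁ ^ₚ i) (L₂ ^ₚ j) x y)
                                  (*-cong (ε-^ₚ L₁ i x y) (ε-^ₚ L₂ j x y)))) ⟩
    a * ((ε L₁ x y ^F i) * (ε L₂ x y ^F j)) + ε p (ε L₁ x y) (ε L₂ x y) ∎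
    where M = (L₁ ^ₚ i) *ₚ (L₂ ^ₚ j)

  ε-linForm : ∀ a b x y → ε (linForm a b) x y ≈ a * x + b * y
  ε-linForm = solve 4 (λ a b x y → a :* ((x :* K 1) :* K 1) :+ (b :* (K 1 :* (y :* K 1)) :+ K 0)
                                    := a :* x :+ b :* y) refl

  ε-cong : ∀ p {x x′ y y′} → x ≈ x′ → y ≈ y′ → ε p x y ≈ ε p x′ y′
  ε-cong p {x} {x′} {y} {y′} x≈x′ y≈y′ rewrite ε≡extend p x y | ε≡extend p x′ y′ =
    extend-cong (λ k l → *-cong (^F-cong k x≈x′) (^F-cong l y≈y′)) p

  ε-act : ∀ h p x y →
          ε (act h p) x y ≈ ε p (h i₁ i₁ * x + h i₂ i₁ * y) (h i₁ i₂ * x + h i₂ i₂ * y)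
  ε-act h p x y = trans (ε-subst p _ _ x y) (ε-cong p (ε-linForm _ _ x y) (ε-linForm _ _ x y))

  subst-++ : ∀ p q L₁ L₂ → subst (p ++ q) L₁ L₂ ≡ subst p L₁ L₂ ++ subst q L₁ L₂
  subst-++ []                q L₁ L₂ = ≡.refl
  subst-++ ((a , i , j) ∷ p) q L₁ L₂ =
    ≡.trans (≡.cong ((a ·ₚ ((L₁ ^ₚ i) *ₚ (L₂ ^ₚ j))) ++_) (subst-++ p q L₁ L₂))
            (≡.sym (List.++-assoc (a ·ₚ ((L₁ ^ₚ i) *ₚ (L₂ ^ₚ j))) (subst p L₁ L₂) (subst q L₁ L₂)))

  extend-subst-·ₚ : ∀ g a p L₁ L₂ → extend g (subst (a ·ₚ p) L₁ L₂) ≈ a * extend g (subst p L₁ L₂)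
  extend-subst-·ₚ g a []                L₁ L₂ = sym (zeroʳ a)
  extend-subst-·ₚ g a ((b , i , j) ∷ p) L₁ L₂ = begin
    extend g (((a * b) ·ₚ M) ++ subst (a ·ₚ p) L₁ L₂)
      ≈⟨ extend-++ g ((a * b) ·ₚ M) _ ⟩
    extend g ((a * b) ·ₚ M) + extend g (subst (a ·ₚ p) L₁ L₂)
      ≈⟨ +-cong (extend-·ₚ g (a * b) M) (extend-subst-·ₚ g a p L₁ L₂) ⟩
    (a * b) * extend g M + a * extend g (subst p L₁ L₂)
      ≈⟨ solve 4 (λ a b x y → (a :* b) :* x :+ a :* y := a :* (b :* x :+ y)) refl a b (extend g M) _ ⟩
    a * (b * extend g M + extend g (subst p L₁ L₂))
      ≈⟨ *-congˡ (sym (trans (extend-++ g (b ·ₚ M) _) (+-congʳ (extend-·ₚ g b M)))) ⟩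
    a * extend g ((b ·ₚ M) ++ subst p L₁ L₂) ∎
    where M = (L₁ ^ₚ i) *ₚ (L₂ ^ₚ j)

  mono : ℕ → ℕ → Poly
  mono k l = (1# , k , l) ∷ []

  ε-mono : ∀ k l x y → ε (mono k l) x y ≈ monomialAt x y k l
  ε-mono k l x y = trans (+-identityʳ _) (*-identityˡ _)

  ε-mono-*ₚ : ∀ k l p x y → ε (mono k l *ₚ p) x y ≈ monomialAt x y k l * ε p x y
  ε-mono-*ₚ k l p x y = trans (ε-*ₚ (mono k l) p x y) (*-congʳ (ε-mono k l x y))

  x+x≈y+y⇒x≈y : ¬ (1# + 1# ≈ 0#) → ∀ {x y} → x + x ≈ y + y → x ≈ y
  x+x≈y+y⇒x≈y 2≉0 {x} {y} x+x≈y+y = *-cancelˡ (1# + 1#) 2≉0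
    (trans (solve 1 (λ x → K 2 :* x := x :+ x) refl x)
      (trans x+x≈y+y (solve 1 (λ y → y :+ y := K 2 :* y) refl y)))

  OnS¹ : Carrier → Carrier → Set ℓ
  OnS¹ x y = x * x + y * y ≈ 1#

  _≈on-S¹_ : Poly → Poly → Set (c ⊔ ℓ)
  p ≈on-S¹ q = ∀ x y → OnS¹ x y → ε p x y ≈ ε q x y

  record IsLocalLinear (φ : Poly → Carrier) : Set (c ⊔ ℓ) where
    field
      φ-++    : ∀ p q → φ (p ++ q) ≈ φ p + φ q
      φ-·ₚ    : ∀ a p → φ (a ·ₚ p) ≈ a * φ p
      φ-local : ∀ p → (∀ x y → OnS¹ x y → ε p x y ≈ 0#) → φ p ≈ 0#

    φ-[] : φ [] ≈ 0#
    φ-[] = φ-local [] (λ _ _ _ → refl)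

    φ-combination : ∀ a p b q → φ ((a ·ₚ p) ++ (b ·ₚ q)) ≈ a * φ p + b * φ q
    φ-combination a p b q = trans (φ-++ (a ·ₚ p) (b ·ₚ q)) (+-cong (φ-·ₚ a p) (φ-·ₚ b q))

    φ-resp-≈on-S¹ : ∀ {p q} → p ≈on-S¹ q → φ p ≈ φ q
    φ-resp-≈on-S¹ {p} {q} p≈q = begin
      φ p                                ≈⟨ solve 2 (λ a b → a := (a :+ (:- K 1) :* b) :+ b) refl (φ p) (φ q) ⟩
      (φ p + (- 1#) * φ q) + φ q          ≈⟨ +-congʳ (sym (trans (φ-++ p _) (+-congˡ (φ-·ₚ (- 1#) q)))) ⟩
      φ (p ++ ((- 1#) ·ₚ q)) + φ q         ≈⟨ +-congʳ (φ-local _ p-q≈0) ⟩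
      0# + φ q                           ≈⟨ +-identityˡ _ ⟩
      φ q                                ∎
      where
      p-q≈0 : ∀ x y → OnS¹ x y → ε (p ++ ((- 1#) ·ₚ q)) x y ≈ 0#
      p-q≈0 x y on = begin
        ε (p ++ ((- 1#) ·ₚ q)) x y       ≈⟨ ε-++ p ((- 1#) ·ₚ q) x y ⟩
        ε p x y + ε ((- 1#) ·ₚ q) x y    ≈⟨ +-cong (p≈q x y on) (ε-·ₚ (- 1#) q x y) ⟩
        ε q x y + (- 1#) * ε q x y       ≈⟨ solve 1 (λ b → b :+ (:- K 1) :* b := K 0) refl (ε q x y) ⟩
        0#                               ∎

    φ≈extend : ∀ p → φ p ≈ extend (λ k l → φ (mono k l)) p
    φ≈extend []                = φ-[]
    φ≈extend ((a , k , l) ∷ p) = begin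
      φ (((a , k , l) ∷ []) ++ p)             ≈⟨ φ-++ ((a , k , l) ∷ []) p ⟩
      φ ((a , k , l) ∷ []) + φ p              ≈⟨ +-cong (φ-resp-≈on-S¹ term≈) (φ≈extend p) ⟩
      φ (a ·ₚ mono k l) + extend _ p           ≈⟨ +-congʳ (φ-·ₚ a (mono k l)) ⟩
      a * φ (mono k l) + extend _ p            ∎
      where
      term≈ : ((a , k , l) ∷ []) ≈on-S¹ (a ·ₚ mono k l)
      term≈ _ _ _ = +-congʳ (*-congʳ (sym (*-identityʳ a)))

  -- The harmonics: P j + i Q j = (α₁ + i α₂)ʲ.
  α₁ α₂ : Poly
  α₁ = mono 1 0
  α₂ = mono 0 1

  P Q : ℕ → Poly
  P zero    = 𝟏
  P (suc j) = (α₁ *ₚ P j) ++ ((- 1#) ·ₚ (α₂ *ₚ Q j))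
  Q zero    = []
  Q (suc j) = (α₂ *ₚ P j) ++ (α₁ *ₚ Q j)

  Re Im : ℕ → Carrier → Carrier → Carrier
  Re zero    x y = 1#
  Re (suc j) x y = x * Re j x y - y * Im j x y
  Im zero    x y = 0#
  Im (suc j) x y = y * Re j x y + x * Im j x y

  ε-α₁ : ∀ x y → ε α₁ x y ≈ x
  ε-α₁ x y = solve 1 (λ x → K 1 :* ((x :* K 1) :* K 1) :+ K 0 := x) refl x

  ε-α₂ : ∀ x y → ε α₂ x y ≈ y
  ε-α₂ x y = solve 1 (λ y → K 1 :* (K 1 :* (y :* K 1)) :+ K 0 := y) refl y

  ε-P×ε-Q : ∀ j x y → (ε (P j) x y ≈ Re j x y) × (ε (Q j) x y ≈ Im j x y)
  ε-P×ε-Q zero    x y = ε-𝟏 x y , refl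
  ε-P×ε-Q (suc j) x y = ε-P , ε-Q
    where
    IH = ε-P×ε-Q j x y
    ε-α₁*ₚ : ∀ p v → ε p x y ≈ v → ε (α₁ *ₚ p) x y ≈ x * v
    ε-α₁*ₚ p v eq = trans (ε-*ₚ α₁ p x y) (*-cong (ε-α₁ x y) eq)
    ε-α₂*ₚ : ∀ p v → ε p x y ≈ v → ε (α₂ *ₚ p) x y ≈ y * v
    ε-α₂*ₚ p v eq = trans (ε-*ₚ α₂ p x y) (*-cong (ε-α₂ x y) eq)
    ε-P : ε (P (suc j)) x y ≈ Re (suc j) x y
    ε-P = trans (ε-++ (α₁ *ₚ P j) ((- 1#) ·ₚ (α₂ *ₚ Q j)) x y)
      (trans (+-cong (ε-α₁*ₚ (P j) _ (proj₁ IH))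
                     (trans (ε-·ₚ (- 1#) (α₂ *ₚ Q j) x y) (*-congˡ (ε-α₂*ₚ (Q j) _ (proj₂ IH)))))
             (solve 2 (λ a b → a :+ (:- K 1) :* b := a :- b) refl _ _))
    ε-Q : ε (Q (suc j)) x y ≈ Im (suc j) x y
    ε-Q = trans (ε-++ (α₂ *ₚ P j) (α₁ *ₚ Q j) x y)
      (+-cong (ε-α₂*ₚ (P j) _ (proj₁ IH)) (ε-α₁*ₚ (Q j) _ (proj₂ IH)))

  ε-P : ∀ j x y → ε (P j) x y ≈ Re j x y
  ε-P j x y = proj₁ (ε-P×ε-Q j x y)

  ε-Q : ∀ j x y → ε (Q j) x y ≈ Im j x y
  ε-Q j x y = proj₂ (ε-P×ε-Q j x y)

  -- On the circle x - i y = (x + i y)⁻¹, which gives the three-term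
  -- (Chebyshev) recurrences below.
  module ChebyshevOnS¹ {x y : Carrier} (on : OnS¹ x y) where
    private
      unit : ∀ a → (x * x + y * y) * a ≈ a
      unit a = trans (*-congʳ on) (*-identityˡ a)

    Re-pred : ∀ j → Re j x y ≈ x * Re (suc j) x y + y * Im (suc j) x y
    Re-pred j = sym (trans
      (solve 4 (λ x y p q → x :* (x :* p :- y :* q) :+ y :* (y :* p :+ x :* q) := (x :* x :+ y :* y) :* p)
        refl x y (Re j x y) (Im j x y))
      (unit _))

    Im-pred : ∀ j → Im j x y ≈ x * Im (suc j) x y - y * Re (suc j) x y
    Im-pred j = sym (trans
      (solve 4 (λ x y p q → x :* (y :* p :+ x :* q) :- y :* (x :* p :- y :* q) := (x :* x :+ y :* y) :* q)
        refl x y (Re j x y) (Im j x y))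
      (unit _))

    Re-recˣ : ∀ j → Re (suc (suc j)) x y + Re j x y ≈ (x + x) * Re (suc j) x y
    Re-recˣ j = trans (+-congˡ (Re-pred j))
      (solve 4 (λ x y p q → (x :* p :- y :* q) :+ (x :* p :+ y :* q) := (x :+ x) :* p)
        refl x y (Re (suc j) x y) (Im (suc j) x y))

    Im-recˣ : ∀ j → Im (suc (suc j)) x y + Im j x y ≈ (x + x) * Im (suc j) x y
    Im-recˣ j = trans (+-congˡ (Im-pred j))
      (solve 4 (λ x y p q → (y :* p :+ x :* q) :+ (x :* q :- y :* p) := (x :+ x) :* q)
        refl x y (Re (suc j) x y) (Im (suc j) x y))

    Im-recʸ : ∀ j → Im (suc (suc j)) x y + (- 1#) * Im j x y ≈ (y + y) * Re (suc j) x y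
    Im-recʸ j = trans (+-congˡ (*-congˡ (Im-pred j)))
      (solve 4 (λ x y p q → (y :* p :+ x :* q) :+ (:- K 1) :* (x :* q :- y :* p) := (y :+ y) :* p)
        refl x y (Re (suc j) x y) (Im (suc j) x y))

    Re-recʸ : ∀ j → Re j x y + (- 1#) * Re (suc (suc j)) x y ≈ (y + y) * Im (suc j) x y
    Re-recʸ j = trans (+-congʳ (Re-pred j))
      (solve 4 (λ x y p q → (x :* p :+ y :* q) :+ (:- K 1) :* (x :* p :- y :* q) := (y :+ y) :* q)
        refl x y (Re (suc j) x y) (Im (suc j) x y))

  ε-P-recˣ : ∀ j x y → OnS¹ x y → ε (P (suc (suc j))) x y + ε (P j) x y ≈ (x + x) * ε (P (suc j)) x y
  ε-P-recˣ j x y on = trans (+-cong (ε-P (suc (suc j)) x y) (ε-P j x y))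
    (trans (ChebyshevOnS¹.Re-recˣ on j) (*-congˡ (sym (ε-P (suc j) x y))))

  ε-Q-recˣ : ∀ j x y → OnS¹ x y → ε (Q (suc (suc j))) x y + ε (Q j) x y ≈ (x + x) * ε (Q (suc j)) x y
  ε-Q-recˣ j x y on = trans (+-cong (ε-Q (suc (suc j)) x y) (ε-Q j x y))
    (trans (ChebyshevOnS¹.Im-recˣ on j) (*-congˡ (sym (ε-Q (suc j) x y))))

  ε-P-recʸ : ∀ j x y → OnS¹ x y →
             ε (Q (suc (suc j))) x y + (- 1#) * ε (Q j) x y ≈ (y + y) * ε (P (suc j)) x y
  ε-P-recʸ j x y on = trans (+-cong (ε-Q (suc (suc j)) x y) (*-congˡ (ε-Q j x y)))
    (trans (ChebyshevOnS¹.Im-recʸ on j) (*-congˡ (sym (ε-P (suc j) x y))))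

  ε-Q-recʸ : ∀ j x y → OnS¹ x y →
             ε (P j) x y + (- 1#) * ε (P (suc (suc j))) x y ≈ (y + y) * ε (Q (suc j)) x y
  ε-Q-recʸ j x y on = trans (+-cong (ε-P j x y) (*-congˡ (ε-P (suc (suc j)) x y)))
    (trans (ChebyshevOnS¹.Re-recʸ on j) (*-congˡ (sym (ε-Q (suc j) x y))))

  α₁-doubleˣ : ∀ k l h a b → (∀ x y → OnS¹ x y → ε a x y + ε b x y ≈ (x + x) * ε h x y) →
               ((mono (suc k) l *ₚ h) ++ (mono (suc k) l *ₚ h)) ≈on-S¹ ((mono k l *ₚ a) ++ (mono k l *ₚ b))
  α₁-doubleˣ k l h a b rec x y on = begin
    ε ((mono (suc k) l *ₚ h) ++ (mono (suc k) l *ₚ h)) x y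
      ≈⟨ trans (ε-++ (mono (suc k) l *ₚ h) _ x y) (+-cong (ε-mono-*ₚ _ l h x y) (ε-mono-*ₚ _ l h x y)) ⟩
    ((x * X) * Y) * ε h x y + ((x * X) * Y) * ε h x y
      ≈⟨ solve 4 (λ x X Y h → ((x :* X) :* Y) :* h :+ ((x :* X) :* Y) :* h := (X :* Y) :* ((x :+ x) :* h))
           refl x X Y (ε h x y) ⟩
    (X * Y) * ((x + x) * ε h x y)          ≈⟨ *-congˡ (sym (rec x y on)) ⟩
    (X * Y) * (ε a x y + ε b x y)          ≈⟨ distribˡ (X * Y) _ _ ⟩
    (X * Y) * ε a x y + (X * Y) * ε b x y
      ≈⟨ sym (trans (ε-++ (mono k l *ₚ a) _ x y) (+-cong (ε-mono-*ₚ k l a x y) (ε-mono-*ₚ k l b x y))) ⟩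
    ε ((mono k l *ₚ a) ++ (mono k l *ₚ b)) x y ∎
    where
    X = x ^F k
    Y = y ^F l

  α₂-doubleʸ : ∀ k l h a b → (∀ x y → OnS¹ x y → ε a x y + (- 1#) * ε b x y ≈ (y + y) * ε h x y) →
               ((mono k (suc l) *ₚ h) ++ (mono k (suc l) *ₚ h))
                 ≈on-S¹ ((mono k l *ₚ a) ++ ((- 1#) ·ₚ (mono k l *ₚ b)))
  α₂-doubleʸ k l h a b rec x y on = begin
    ε ((mono k (suc l) *ₚ h) ++ (mono k (suc l) *ₚ h)) x y
      ≈⟨ trans (ε-++ (mono k (suc l) *ₚ h) _ x y) (+-cong (ε-mono-*ₚ k _ h x y) (ε-mono-*ₚ k _ h x y)) ⟩
    (X * (y * Y)) * ε h x y + (X * (y * Y)) * ε h x y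
      ≈⟨ solve 4 (λ y X Y h → (X :* (y :* Y)) :* h :+ (X :* (y :* Y)) :* h := (X :* Y) :* ((y :+ y) :* h))
           refl y X Y (ε h x y) ⟩
    (X * Y) * ((y + y) * ε h x y)                       ≈⟨ *-congˡ (sym (rec x y on)) ⟩
    (X * Y) * (ε a x y + (- 1#) * ε b x y)
      ≈⟨ solve 3 (λ m a b → m :* (a :+ (:- K 1) :* b) := m :* a :+ (:- K 1) :* (m :* b))
           refl (X * Y) (ε a x y) (ε b x y) ⟩
    (X * Y) * ε a x y + (- 1#) * ((X * Y) * ε b x y)
      ≈⟨ sym (trans (ε-++ (mono k l *ₚ a) _ x y)
               (+-cong (ε-mono-*ₚ k l a x y) (trans (ε-·ₚ (- 1#) (mono k l *ₚ b) x y) (*-congˡ (ε-mono-*ₚ k l b x y))))) ⟩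
    ε ((mono k l *ₚ a) ++ ((- 1#) ·ₚ (mono k l *ₚ b))) x y ∎
    where
    X = x ^F k
    Y = y ^F l

  record IsHarmonicAverage (φ : Poly → Carrier) : Set (c ⊔ ℓ) where
    field
      localLinear : IsLocalLinear φ
      φ-𝟏         : φ 𝟏 ≈ 1#
      φ-P         : ∀ j → φ (P (suc j)) ≈ 0#
      φ-Q         : ∀ j → φ (Q (suc j)) ≈ 0#
    open IsLocalLinear localLinear public

  -- Multiplying a harmonic by α₁ or α₂ gives, on S¹, half a sum of two
  -- harmonics; so agreement on all mono k l *ₚ harmonic propagates from
  -- (k , l) to (k + 1 , l) and (k , l + 1), and mono k l = mono k l *ₚ P 0.
  module _ (2≉0 : ¬ (1# + 1# ≈ 0#)) {φ φ′ : Poly → Carrier}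
           (A : IsHarmonicAverage φ) (A′ : IsHarmonicAverage φ′) where
    private
      module A  = IsHarmonicAverage A
      module A′ = IsHarmonicAverage A′

      Agree : Poly → Set ℓ
      Agree p = φ p ≈ φ′ p

      agree-≈on-S¹ : ∀ {p q} → p ≈on-S¹ q → Agree q → Agree p
      agree-≈on-S¹ p≈q agree = trans (A.φ-resp-≈on-S¹ p≈q) (trans agree (sym (A′.φ-resp-≈on-S¹ p≈q)))

      agree-double : ∀ {p q r} → (p ++ p) ≈on-S¹ (q ++ r) → Agree q → Agree r → Agree p
      agree-double {p} {q} {r} 2p≈q+r agree-q agree-r = x+x≈y+y⇒x≈y 2≉0 (begin
        φ p + φ p       ≈⟨ sym (A.φ-++ p p) ⟩
        φ (p ++ p)      ≈⟨ agree-≈on-S¹ 2p≈q+r (trans (A.φ-++ q r)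
                             (trans (+-cong agree-q agree-r) (sym (A′.φ-++ q r)))) ⟩
        φ′ (p ++ p)     ≈⟨ A′.φ-++ p p ⟩
        φ′ p + φ′ p     ∎)

      agree-neg : ∀ {p} → Agree p → Agree ((- 1#) ·ₚ p)
      agree-neg {p} agree = trans (A.φ-·ₚ (- 1#) p) (trans (*-congˡ agree) (sym (A′.φ-·ₚ (- 1#) p)))

      agree-[] : Agree []
      agree-[] = trans A.φ-[] (sym A′.φ-[])

      AgreeOnHarmonics : ℕ → ℕ → Set ℓ
      AgreeOnHarmonics k l = ∀ j → Agree (mono k l *ₚ P j) × Agree (mono k l *ₚ Q j)

      mono-*ₚ-≈ : ∀ k l k′ l′ h h′ → (∀ x y → monomialAt x y k l * ε h x y ≈ monomialAt x y k′ l′ * ε h′ x y) →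
                  (mono k l *ₚ h) ≈on-S¹ (mono k′ l′ *ₚ h′)
      mono-*ₚ-≈ k l k′ l′ h h′ eq x y _ =
        trans (ε-mono-*ₚ k l h x y) (trans (eq x y) (sym (ε-mono-*ₚ k′ l′ h′ x y)))

      agree-harmonics₀₀ : AgreeOnHarmonics 0 0
      agree-harmonics₀₀ j = agree-≈on-S¹ (unit (P j)) (agree-P j) , agree-≈on-S¹ (unit (Q j)) (agree-Q j)
        where
        unit : ∀ h → (mono 0 0 *ₚ h) ≈on-S¹ h
        unit h x y _ = trans (ε-mono-*ₚ 0 0 h x y) (trans (*-congʳ (*-identityˡ 1#)) (*-identityˡ _))
        agree-P : ∀ j → Agree (P j)
        agree-P zero    = trans A.φ-𝟏 (sym A′.φ-𝟏)
        agree-P (suc j) = trans (A.φ-P j) (sym (A′.φ-P j))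
        agree-Q : ∀ j → Agree (Q j)
        agree-Q zero    = agree-[]
        agree-Q (suc j) = trans (A.φ-Q j) (sym (A′.φ-Q j))

      agree-harmonics-sucˡ : ∀ k l → AgreeOnHarmonics k l → AgreeOnHarmonics (suc k) l
      agree-harmonics-sucˡ k l IH zero = agree-≈on-S¹ (mono-*ₚ-≈ (suc k) l k l (P 0) (P 1) x·1≈Re₁) (proj₁ (IH 1)) , agree-[]
        where
        x·1≈Re₁ : ∀ x y → monomialAt x y (suc k) l * ε (P 0) x y ≈ monomialAt x y k l * ε (P 1) x y
        x·1≈Re₁ x y = trans (*-congˡ (ε-P 0 x y)) (trans
          (solve 4 (λ x y X Y → ((x :* X) :* Y) :* K 1 := (X :* Y) :* (x :* K 1 :- y :* K 0))
            refl x y (x ^F k) (y ^F l))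
          (*-congˡ (sym (ε-P 1 x y))))
      agree-harmonics-sucˡ k l IH (suc j) =
        agree-double (α₁-doubleˣ k l (P (suc j)) (P (suc (suc j))) (P j) (ε-P-recˣ j)) (proj₁ (IH (suc (suc j)))) (proj₁ (IH j)) ,
        agree-double (α₁-doubleˣ k l (Q (suc j)) (Q (suc (suc j))) (Q j) (ε-Q-recˣ j)) (proj₂ (IH (suc (suc j)))) (proj₂ (IH j))

      agree-harmonics-sucʳ : ∀ k l → AgreeOnHarmonics k l → AgreeOnHarmonics k (suc l)
      agree-harmonics-sucʳ k l IH zero = agree-≈on-S¹ (mono-*ₚ-≈ k (suc l) k l (P 0) (Q 1) y·1≈Im₁) (proj₂ (IH 1)) , agree-[]
        where
        y·1≈Im₁ : ∀ x y → monomialAt x y k (suc l) * ε (P 0) x y ≈ monomialAt x y k l * ε (Q 1) x y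
        y·1≈Im₁ x y = trans (*-congˡ (ε-P 0 x y)) (trans
          (solve 4 (λ x y X Y → (X :* (y :* Y)) :* K 1 := (X :* Y) :* (y :* K 1 :+ x :* K 0))
            refl x y (x ^F k) (y ^F l))
          (*-congˡ (sym (ε-Q 1 x y))))
      agree-harmonics-sucʳ k l IH (suc j) =
        agree-double (α₂-doubleʸ k l (P (suc j)) (Q (suc (suc j))) (Q j) (ε-P-recʸ j))
          (proj₂ (IH (suc (suc j)))) (agree-neg (proj₂ (IH j))) ,
        agree-double (α₂-doubleʸ k l (Q (suc j)) (P j) (P (suc (suc j))) (ε-Q-recʸ j))
          (proj₁ (IH j)) (agree-neg (proj₁ (IH (suc (suc j)))))

      agree-harmonics : ∀ k l → AgreeOnHarmonics k l
      agree-harmonics zero    zero    = agree-harmonics₀₀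
      agree-harmonics (suc k) zero    = agree-harmonics-sucˡ k zero (agree-harmonics k zero)
      agree-harmonics k       (suc l) = agree-harmonics-sucʳ k l (agree-harmonics k l)

      agree-mono : ∀ k l → Agree (mono k l)
      agree-mono k l = agree-≈on-S¹ mono≈mono*P₀ (proj₁ (agree-harmonics k l 0))
        where
        mono≈mono*P₀ : mono k l ≈on-S¹ (mono k l *ₚ P 0)
        mono≈mono*P₀ x y _ = trans (ε-mono k l x y)
          (sym (trans (ε-mono-*ₚ k l (P 0) x y) (trans (*-congˡ (ε-P 0 x y)) (*-identityʳ _))))

    harmonicAverage-unique : ∀ p → φ p ≈ φ′ p
    harmonicAverage-unique p =
      trans (A.φ≈extend p) (trans (extend-cong agree-mono p) (sym (A′.φ≈extend p)))

  -- cosₙ c s j + i sinₙ c s j = (c + i s)ʲ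
  cosₙ sinₙ : Carrier → Carrier → ℕ → Carrier
  cosₙ c s zero    = 1#
  cosₙ c s (suc j) = c * cosₙ c s j - s * sinₙ c s j
  sinₙ c s zero    = 0#
  sinₙ c s (suc j) = s * cosₙ c s j + c * sinₙ c s j

  Re×Im-rotate : ∀ c s j x y →
    (Re j (c * x - s * y) (s * x + c * y) ≈ cosₙ c s j * Re j x y - sinₙ c s j * Im j x y)
    × (Im j (c * x - s * y) (s * x + c * y) ≈ sinₙ c s j * Re j x y + cosₙ c s j * Im j x y)
  Re×Im-rotate c s zero x y =
    solve 1 (λ a → K 1 := K 1 :* K 1 :- K 0 :* a) refl (Im 0 x y) ,
    solve 1 (λ a → K 0 := K 0 :* K 1 :+ K 1 :* K 0) refl (Im 0 x y)
  Re×Im-rotate c s (suc j) x y =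
    trans (+-cong (*-congˡ (proj₁ IH)) (-‿cong (*-congˡ (proj₂ IH))))
      (solve 8 (λ c s x y C S p q →
                  (c :* x :- s :* y) :* (C :* p :- S :* q) :- (s :* x :+ c :* y) :* (S :* p :+ C :* q)
                  := (c :* C :- s :* S) :* (x :* p :- y :* q) :- (s :* C :+ c :* S) :* (y :* p :+ x :* q))
         refl c s x y (cosₙ c s j) (sinₙ c s j) (Re j x y) (Im j x y)) ,
    trans (+-cong (*-congˡ (proj₁ IH)) (*-congˡ (proj₂ IH)))
      (solve 8 (λ c s x y C S p q →
                  (s :* x :+ c :* y) :* (C :* p :- S :* q) :+ (c :* x :- s :* y) :* (S :* p :+ C :* q)
                  := (s :* C :+ c :* S) :* (x :* p :- y :* q) :+ (c :* C :- s :* S) :* (y :* p :+ x :* q))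
         refl c s x y (cosₙ c s j) (sinₙ c s j) (Re j x y) (Im j x y))
    where IH = Re×Im-rotate c s j x y

  cosₙ²+sinₙ²≈1 : ∀ c s → c * c + s * s ≈ 1# → ∀ j →
                  cosₙ c s j * cosₙ c s j + sinₙ c s j * sinₙ c s j ≈ 1#
  cosₙ²+sinₙ²≈1 c s c²+s²≈1 zero    = solve 0 (K 1 :* K 1 :+ K 0 :* K 0 := K 1) refl
  cosₙ²+sinₙ²≈1 c s c²+s²≈1 (suc j) = begin
    (c * C - s * S) * (c * C - s * S) + (s * C + c * S) * (s * C + c * S)
      ≈⟨ solve 4 (λ c s C S → (c :* C :- s :* S) :* (c :* C :- s :* S) :+ (s :* C :+ c :* S) :* (s :* C :+ c :* S)
                              := (c :* c :+ s :* s) :* (C :* C :+ S :* S)) refl c s C S ⟩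
    (c * c + s * s) * (C * C + S * S) ≈⟨ *-cong c²+s²≈1 (cosₙ²+sinₙ²≈1 c s c²+s²≈1 j) ⟩
    1# * 1#                           ≈⟨ *-identityˡ 1# ⟩
    1#                                ∎
    where
    C = cosₙ c s j
    S = sinₙ c s j

  -- 2 (1 − C) u and 2 (1 − C) v are linear combinations of the two
  -- fixed-point equations and of C² + S² = 1.
  rotation-fixedPoint≈0 : ¬ (1# + 1# ≈ 0#) → ∀ C S u v → C * C + S * S ≈ 1# → ¬ (C ≈ 1#) →
                          u ≈ C * u + (- S) * v → v ≈ S * u + C * v → (u ≈ 0#) × (v ≈ 0#)
  rotation-fixedPoint≈0 2≉0 C S u v C²+S²≈1 C≉1 u-fixed v-fixed =
    a*x≈0⇒x≈0 d d≉0 (d*u≈0) , a*x≈0⇒x≈0 d d≉0 (d*v≈0)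
    where
    d = (1# + 1#) * (1# - C)
    E₁ = u - (C * u + (- S) * v)
    E₂ = v - (S * u + C * v)
    E₃ = (C * C + S * S) - 1#
    E₁≈0 : E₁ ≈ 0#
    E₁≈0 = trans (+-congʳ u-fixed) (-‿inverseʳ _)
    E₂≈0 : E₂ ≈ 0#
    E₂≈0 = trans (+-congʳ v-fixed) (-‿inverseʳ _)
    E₃≈0 : E₃ ≈ 0#
    E₃≈0 = trans (+-congʳ C²+S²≈1) (-‿inverseʳ _)
    combination≈0 : ∀ a b e → a * E₁ + b * E₂ + e * E₃ ≈ 0#
    combination≈0 a b e = trans (+-cong (+-cong (*-congˡ E₁≈0) (*-congˡ E₂≈0)) (*-congˡ E₃≈0))
      (solve 3 (λ a b e → a :* K 0 :+ b :* K 0 :+ e :* K 0 := K 0) refl a b e)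
    d*u≈0 : d * u ≈ 0#
    d*u≈0 = trans
      (solve 4 (λ C S u v → (K 2 :* (K 1 :- C)) :* u :=
                 (K 1 :- C) :* (u :- (C :* u :+ (:- S) :* v)) :+ (:- S) :* (v :- (S :* u :+ C :* v))
                 :+ (:- u) :* ((C :* C :+ S :* S) :- K 1)) refl C S u v)
      (combination≈0 (1# - C) (- S) (- u))
    d*v≈0 : d * v ≈ 0#
    d*v≈0 = trans
      (solve 4 (λ C S u v → (K 2 :* (K 1 :- C)) :* v :=
                 S :* (u :- (C :* u :+ (:- S) :* v)) :+ (K 1 :- C) :* (v :- (S :* u :+ C :* v))
                 :+ (:- v) :* ((C :* C :+ S :* S) :- K 1)) refl C S u v)
      (combination≈0 S (1# - C) (- v))
    d≉0 : ¬ (d ≈ 0#)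
    d≉0 d≈0 = C≉1 (sym (begin
      1#             ≈⟨ solve 1 (λ C → K 1 := (K 1 :- C) :+ C) refl C ⟩
      (1# - C) + C   ≈⟨ +-congʳ (a*x≈0⇒x≈0 (1# + 1#) 2≉0 d≈0) ⟩
      0# + C         ≈⟨ +-identityˡ C ⟩
      C              ∎))

  module SO2 {h : Mat} (h∈SO2 : InSO2 h) where
    open InSO2 h∈SO2
    private
      a = h i₁ i₁
      b = h i₁ i₂
      c′ = h i₂ i₁
      d = h i₂ i₂

    d≈a : d ≈ a
    d≈a = sym (begin
      a                                      ≈⟨ sym (trans (*-congˡ det-one) (*-identityʳ a)) ⟩
      a * (a * d - b * c′)
        ≈⟨ solve 4 (λ a b c d → a :* (a :* d :- b :* c) := (a :* a :+ c :* c) :* d :- c :* (a :* b :+ c :* d))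
             refl a b c′ d ⟩
      (a * a + c′ * c′) * d - c′ * (a * b + c′ * d)
        ≈⟨ +-cong (*-congʳ (inv-left i₁ i₁)) (-‿cong (*-congˡ (inv-left i₁ i₂))) ⟩
      1# * d - c′ * 0#                        ≈⟨ solve 2 (λ c d → K 1 :* d :- c :* K 0 := d) refl c′ d ⟩
      d                                      ∎)

    c≈-b : c′ ≈ - b
    c≈-b = begin
      c′                                     ≈⟨ solve 2 (λ c d → c := :- (d :* K 0 :- c :* K 1)) refl c′ d ⟩
      - (d * 0# - c′ * 1#)
        ≈⟨ -‿cong (sym (+-cong (*-congˡ (inv-left i₁ i₂)) (-‿cong (*-congˡ (inv-left i₂ i₂))))) ⟩
      - (d * (a * b + c′ * d) - c′ * (b * b + d * d))
        ≈⟨ -‿cong (solve 4 (λ a b c d → d :* (a :* b :+ c :* d) :- c :* (b :* b :+ d :* d) := b :* (a :* d :- b :* c))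
             refl a b c′ d) ⟩
      - (b * (a * d - b * c′))               ≈⟨ -‿cong (trans (*-congˡ det-one) (*-identityʳ b)) ⟩
      - b                                    ∎

    preserves-S¹ : ∀ {x y} → OnS¹ x y → OnS¹ (a * x + c′ * y) (b * x + d * y)
    preserves-S¹ {x} {y} on = begin
      (a * x + c′ * y) * (a * x + c′ * y) + (b * x + d * y) * (b * x + d * y)
        ≈⟨ solve 6 (λ a b c d x y → (a :* x :+ c :* y) :* (a :* x :+ c :* y) :+ (b :* x :+ d :* y) :* (b :* x :+ d :* y)
                   := (a :* a :+ b :* b) :* (x :* x) :+ (K 2 :* (a :* c :+ b :* d)) :* (x :* y)
                      :+ (c :* c :+ d :* d) :* (y :* y)) refl a b c′ d x y ⟩
      (a * a + b * b) * (x * x) + ((1# + 1#) * (a * c′ + b * d)) * (x * y) + (c′ * c′ + d * d) * (y * y)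
        ≈⟨ +-cong (+-cong (*-congʳ (inv-right i₁ i₁)) (*-congʳ (*-congˡ (inv-right i₁ i₂)))) (*-congʳ (inv-right i₂ i₂)) ⟩
      1# * (x * x) + ((1# + 1#) * 0#) * (x * y) + 1# * (y * y)
        ≈⟨ solve 2 (λ x y → K 1 :* (x :* x) :+ (K 2 :* K 0) :* (x :* y) :+ K 1 :* (y :* y) := x :* x :+ y :* y) refl x y ⟩
      x * x + y * y ≈⟨ on ⟩
      1# ∎

    ε-act-rotation : ∀ p x y → ε (act h p) x y ≈ ε p (a * x - b * y) (b * x + a * y)
    ε-act-rotation p x y = trans (ε-act h p x y) (ε-cong p
      (+-congˡ (trans (*-congʳ c≈-b) (sym (-‿distribˡ-* b y))))
      (+-congˡ (*-congʳ d≈a)))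

    private
      C S : ℕ → Carrier
      C = cosₙ a b
      S = sinₙ a b

    act-P : ∀ j → act h (P j) ≈on-S¹ ((C j ·ₚ P j) ++ ((- S j) ·ₚ Q j))
    act-P j x y _ = begin
      ε (act h (P j)) x y                         ≈⟨ trans (ε-act-rotation (P j) x y) (ε-P j _ _) ⟩
      Re j (a * x - b * y) (b * x + a * y)        ≈⟨ proj₁ (Re×Im-rotate a b j x y) ⟩
      C j * Re j x y - S j * Im j x y
        ≈⟨ solve 4 (λ C S p q → C :* p :- S :* q := C :* p :+ (:- S) :* q) refl (C j) (S j) _ _ ⟩
      C j * Re j x y + (- S j) * Im j x y
        ≈⟨ sym (trans (ε-++ (C j ·ₚ P j) ((- S j) ·ₚ Q j) x y)
                 (+-cong (trans (ε-·ₚ (C j) (P j) x y) (*-congˡ (ε-P j x y)))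
                         (trans (ε-·ₚ (- S j) (Q j) x y) (*-congˡ (ε-Q j x y))))) ⟩
      ε ((C j ·ₚ P j) ++ ((- S j) ·ₚ Q j)) x y    ∎

    act-Q : ∀ j → act h (Q j) ≈on-S¹ ((S j ·ₚ P j) ++ (C j ·ₚ Q j))
    act-Q j x y _ = begin
      ε (act h (Q j)) x y                         ≈⟨ trans (ε-act-rotation (Q j) x y) (ε-Q j _ _) ⟩
      Im j (a * x - b * y) (b * x + a * y)        ≈⟨ proj₂ (Re×Im-rotate a b j x y) ⟩
      S j * Re j x y + C j * Im j x y
        ≈⟨ sym (trans (ε-++ (S j ·ₚ P j) (C j ·ₚ Q j) x y)
                 (+-cong (trans (ε-·ₚ (S j) (P j) x y) (*-congˡ (ε-P j x y)))
                         (trans (ε-·ₚ (C j) (Q j) x y) (*-congˡ (ε-Q j x y))))) ⟩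
      ε ((S j ·ₚ P j) ++ (C j ·ₚ Q j)) x y        ∎

    module _ {φ : Poly → Carrier} (L : IsLocalLinear φ) where
      open IsLocalLinear L

      φ-act-P : ∀ j → φ (act h (P j)) ≈ C j * φ (P j) + (- S j) * φ (Q j)
      φ-act-P j = trans (φ-resp-≈on-S¹ (act-P j)) (φ-combination (C j) (P j) (- S j) (Q j))

      φ-act-Q : ∀ j → φ (act h (Q j)) ≈ S j * φ (P j) + C j * φ (Q j)
      φ-act-Q j = trans (φ-resp-≈on-S¹ (act-Q j)) (φ-combination (S j) (P j) (C j) (Q j))

  rotation : Carrier → Carrier → Mat
  rotation c s Fin.zero    Fin.zero    = c
  rotation c s Fin.zero    (Fin.suc _) = s
  rotation c s (Fin.suc _) Fin.zero    = - s
  rotation c s (Fin.suc _) (Fin.suc _) = c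

  rotation∈SO2 : ∀ {c s} → c * c + s * s ≈ 1# → InSO2 (rotation c s)
  rotation∈SO2 {c} {s} c²+s²≈1 = record
    { inv-right = λ { Fin.zero Fin.zero → c²+s²≈1
                    ; Fin.zero (Fin.suc Fin.zero) → solve 2 (λ c s → c :* (:- s) :+ s :* c := K 0) refl c s
                    ; (Fin.suc Fin.zero) Fin.zero → solve 2 (λ c s → (:- s) :* c :+ c :* s := K 0) refl c s
                    ; (Fin.suc Fin.zero) (Fin.suc Fin.zero) →
                        trans (solve 2 (λ c s → (:- s) :* (:- s) :+ c :* c := c :* c :+ s :* s) refl c s) c²+s²≈1 }
    ; inv-left  = λ { Fin.zero Fin.zero →
                        trans (solve 2 (λ c s → c :* c :+ (:- s) :* (:- s) := c :* c :+ s :* s) refl c s) c²+s²≈1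
                    ; Fin.zero (Fin.suc Fin.zero) → solve 2 (λ c s → c :* s :+ (:- s) :* c := K 0) refl c s
                    ; (Fin.suc Fin.zero) Fin.zero → solve 2 (λ c s → s :* c :+ c :* (:- s) := K 0) refl c s
                    ; (Fin.suc Fin.zero) (Fin.suc Fin.zero) → trans (+-comm _ _) c²+s²≈1 }
    ; det-one   = trans (solve 2 (λ c s → c :* c :- s :* (:- s) := c :* c :+ s :* s) refl c s) c²+s²≈1
    }

  UPoly : Set c
  UPoly = List Carrier

  evalU : UPoly → Carrier → Carrier
  evalU []       x = 0#
  evalU (a ∷ as) x = a + x * evalU as x

  _⊕U_ : UPoly → UPoly → UPoly
  []      ⊕U q       = q
  (a ∷ p) ⊕U []      = a ∷ p
  (a ∷ p) ⊕U (b ∷ q) = (a + b) ∷ (p ⊕U q)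

  scaleU : Carrier → UPoly → UPoly
  scaleU a = map (a *_)

  _⊖U_ : UPoly → UPoly → UPoly
  p ⊖U q = p ⊕U scaleU (- 1#) q

  xpow : ℕ → UPoly
  xpow zero    = 1# ∷ []
  xpow (suc k) = 0# ∷ xpow k

  evalU-⊕U : ∀ p q x → evalU (p ⊕U q) x ≈ evalU p x + evalU q x
  evalU-⊕U []      q       x = sym (+-identityˡ _)
  evalU-⊕U (a ∷ p) []      x = sym (+-identityʳ _)
  evalU-⊕U (a ∷ p) (b ∷ q) x = trans (+-congˡ (*-congˡ (evalU-⊕U p q x)))
    (solve 5 (λ a b x P Q → (a :+ b) :+ x :* (P :+ Q) := (a :+ x :* P) :+ (b :+ x :* Q))
      refl a b x (evalU p x) (evalU q x))

  evalU-scaleU : ∀ a p x → evalU (scaleU a p) x ≈ a * evalU p x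
  evalU-scaleU a []      x = sym (zeroʳ a)
  evalU-scaleU a (b ∷ p) x = trans (+-congˡ (*-congˡ (evalU-scaleU a p x)))
    (solve 4 (λ a b x P → a :* b :+ x :* (a :* P) := a :* (b :+ x :* P)) refl a b x (evalU p x))

  evalU-⊖U : ∀ p q x → evalU (p ⊖U q) x ≈ evalU p x + (- 1#) * evalU q x
  evalU-⊖U p q x = trans (evalU-⊕U p (scaleU (- 1#) q) x) (+-congˡ (evalU-scaleU (- 1#) q x))

  evalU-xpow : ∀ k x → evalU (xpow k) x ≈ x ^F k
  evalU-xpow zero    x = trans (+-congˡ (zeroʳ x)) (+-identityʳ 1#)
  evalU-xpow (suc k) x = trans (+-identityˡ _) (*-congˡ (evalU-xpow k x))

  weigh : (ℕ → Carrier) → UPoly → Carrier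
  weigh f []       = 0#
  weigh f (a ∷ as) = a * f 0 + weigh (λ k → f (suc k)) as

  weigh-⊕U : ∀ f p q → weigh f (p ⊕U q) ≈ weigh f p + weigh f q
  weigh-⊕U f []      q       = sym (+-identityˡ _)
  weigh-⊕U f (a ∷ p) []      = sym (+-identityʳ _)
  weigh-⊕U f (a ∷ p) (b ∷ q) = trans (+-congˡ (weigh-⊕U _ p q))
    (solve 5 (λ a b m P Q → (a :+ b) :* m :+ (P :+ Q) := (a :* m :+ P) :+ (b :* m :+ Q))
      refl a b (f 0) (weigh _ p) (weigh _ q))

  weigh-scaleU : ∀ f a p → weigh f (scaleU a p) ≈ a * weigh f p
  weigh-scaleU f a []      = sym (zeroʳ a)
  weigh-scaleU f a (b ∷ p) = trans (+-congˡ (weigh-scaleU _ a p))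
    (solve 4 (λ a b m P → (a :* b) :* m :+ a :* P := a :* (b :* m :+ P)) refl a b (f 0) (weigh _ p))

  weigh-⊖U : ∀ f p q → weigh f (p ⊖U q) ≈ weigh f p + (- 1#) * weigh f q
  weigh-⊖U f p q = trans (weigh-⊕U f p (scaleU (- 1#) q)) (+-congˡ (weigh-scaleU f (- 1#) q))

  weigh-xpow : ∀ f k → weigh f (xpow k) ≈ f k
  weigh-xpow f zero    = trans (+-identityʳ _) (*-identityˡ _)
  weigh-xpow f (suc k) = trans (+-cong (zeroˡ _) (weigh-xpow _ k)) (+-identityˡ _)

  weigh-zero : ∀ f p → All (_≈ 0#) p → weigh f p ≈ 0#
  weigh-zero f []      []             = refl
  weigh-zero f (a ∷ p) (a≈0 ∷ p≈0) =
    trans (+-cong (trans (*-congʳ a≈0) (zeroˡ _)) (weigh-zero _ p p≈0)) (+-identityˡ 0#)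

  -- Synthetic division by x − r.
  quotient : Carrier → UPoly → UPoly
  quotient r []       = []
  quotient r (d ∷ ds) = evalU (d ∷ ds) r ∷ quotient r ds

  length-quotient : ∀ r p → length (quotient r p) ≡ length p
  length-quotient r []       = ≡.refl
  length-quotient r (d ∷ ds) = ≡.cong suc (length-quotient r ds)

  evalU-quotient : ∀ r x p → x * evalU p x - r * evalU p r ≈ (x - r) * evalU (quotient r p) x
  evalU-quotient r x []       = solve 2 (λ r x → x :* K 0 :- r :* K 0 := (x :- r) :* K 0) refl r x
  evalU-quotient r x (d ∷ ds) = begin
    x * (d + x * Dx) - r * (d + r * Dr)
      ≈⟨ solve 5 (λ r x d Dx Dr → x :* (d :+ x :* Dx) :- r :* (d :+ r :* Dr)
                                   := (x :- r) :* (d :+ r :* Dr) :+ x :* (x :* Dx :- r :* Dr)) refl r x d Dx Dr ⟩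
    (x - r) * (d + r * Dr) + x * (x * Dx - r * Dr)
      ≈⟨ +-congˡ (*-congˡ (evalU-quotient r x ds)) ⟩
    (x - r) * (d + r * Dr) + x * ((x - r) * evalU (quotient r ds) x)
      ≈⟨ solve 4 (λ r x e Q → (x :- r) :* e :+ x :* ((x :- r) :* Q) := (x :- r) :* (e :+ x :* Q))
           refl r x (d + r * Dr) (evalU (quotient r ds) x) ⟩
    (x - r) * evalU (quotient r (d ∷ ds)) x ∎
    where
    Dx = evalU ds x
    Dr = evalU ds r

  quotient≈0⇒≈0 : ∀ r a p → All (_≈ 0#) (quotient r p) → evalU (a ∷ p) r ≈ 0# → All (_≈ 0#) (a ∷ p)
  quotient≈0⇒≈0 r a []       []          ar≈0 = trans (sym (trans (+-congˡ (zeroʳ r)) (+-identityʳ a))) ar≈0 ∷ []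
  quotient≈0⇒≈0 r a (d ∷ ds) (d′≈0 ∷ q≈0) ar≈0 = a≈0 ∷ quotient≈0⇒≈0 r d ds q≈0 d′≈0
    where
    a≈0 : a ≈ 0#
    a≈0 = begin
      a                                       ≈⟨ solve 3 (λ a r E → a := (a :+ r :* E) :- r :* E) refl a r (evalU (d ∷ ds) r) ⟩
      (a + r * evalU (d ∷ ds) r) - r * evalU (d ∷ ds) r ≈⟨ +-cong ar≈0 (-‿cong (*-congˡ d′≈0)) ⟩
      0# - r * 0#                             ≈⟨ solve 1 (λ r → K 0 :- r :* K 0 := K 0) refl r ⟩
      0#                                      ∎

  Injective : (ℕ → Carrier) → Set ℓ
  Injective X = ∀ s t → s ≢ t → ¬ (X s ≈ X t)

  infinitelyManyRoots⇒≈0 : ∀ X → Injective X → ∀ p → (∀ t → evalU p (X t) ≈ 0#) → All (_≈ 0#) p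
  infinitelyManyRoots⇒≈0 X X-inj p roots = go (length p) p ≡.refl X X-inj roots
    where
    go : ∀ n p → length p ≡ n → ∀ X → Injective X → (∀ t → evalU p (X t) ≈ 0#) → All (_≈ 0#) p
    go zero    []      _   X X-inj roots = []
    go (suc n) (a ∷ p) len X X-inj roots =
      quotient≈0⇒≈0 r a p
        (go n (quotient r p) (≡.trans (length-quotient r p) (ℕP.suc-injective len))
            (λ t → X (suc t)) (λ s t s≢t → X-inj (suc s) (suc t) (λ eq → s≢t (ℕP.suc-injective eq)))
            quotient-roots)
        (roots 0)
      where
      r = X 0
      quotient-roots : ∀ t → evalU (quotient r p) (X (suc t)) ≈ 0#
      quotient-roots t = a*x≈0⇒x≈0 (s - r) s-r≉0 (begin
        (s - r) * evalU (quotient r p) s   ≈⟨ sym (evalU-quotient r s p) ⟩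
        s * evalU p s - r * evalU p r
          ≈⟨ solve 5 (λ a s r A B → s :* A :- r :* B := (a :+ s :* A) :- (a :+ r :* B))
               refl a s r (evalU p s) (evalU p r) ⟩
        evalU (a ∷ p) s - evalU (a ∷ p) r  ≈⟨ +-cong (roots (suc t)) (-‿cong (roots 0)) ⟩
        0# - 0#                            ≈⟨ -‿inverseʳ 0# ⟩
        0#                                 ∎)
        where
        s = X (suc t)
        s-r≉0 : ¬ (s - r ≈ 0#)
        s-r≉0 s-r≈0 = X-inj (suc t) 0 (λ ()) (trans (solve 2 (λ s r → s := (s :- r) :+ r) refl s r)
                                              (trans (+-congʳ s-r≈0) (+-identityˡ r)))

  -- Reduction modulo α₁² + α₂² − 1: on S¹, α₁ᵏ α₂ˡ = A(α₁) + α₂ B(α₁) with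
  -- A = reduceᴬ k l and B = reduceᴮ k l, using α₂ˡ⁺² = α₂ˡ − α₁² α₂ˡ.
  reduceᴬ reduceᴮ : ℕ → ℕ → UPoly
  reduceᴬ k zero          = xpow k
  reduceᴬ k (suc zero)    = []
  reduceᴬ k (suc (suc l)) = reduceᴬ k l ⊖U reduceᴬ (suc (suc k)) l
  reduceᴮ k zero          = []
  reduceᴮ k (suc zero)    = xpow k
  reduceᴮ k (suc (suc l)) = reduceᴮ k l ⊖U reduceᴮ (suc (suc k)) l

  monomialAt-reduce : ∀ {x y} → OnS¹ x y → ∀ k l →
    monomialAt x y k l ≈ evalU (reduceᴬ k l) x + y * evalU (reduceᴮ k l) x
  monomialAt-reduce {x} {y} on k zero =
    trans (*-identityʳ _) (sym (trans (+-cong (evalU-xpow k x) (zeroʳ y)) (+-identityʳ _)))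
  monomialAt-reduce {x} {y} on k (suc zero) =
    trans (*-congˡ (*-identityʳ y)) (trans (*-comm _ _) (sym (trans (+-identityˡ _) (*-congˡ (evalU-xpow k x)))))
  monomialAt-reduce {x} {y} on k (suc (suc l)) = begin
    (x ^F k) * (y * (y * (y ^F l)))
      ≈⟨ solve 3 (λ X y Y → X :* (y :* (y :* Y)) := (X :* Y) :* (y :* y)) refl (x ^F k) y (y ^F l) ⟩
    ((x ^F k) * (y ^F l)) * (y * y)
      ≈⟨ *-congˡ (trans (solve 2 (λ x y → y :* y := (x :* x :+ y :* y) :- x :* x) refl x y) (+-congʳ on)) ⟩
    ((x ^F k) * (y ^F l)) * (1# - x * x)
      ≈⟨ solve 3 (λ X x Y → (X :* Y) :* (K 1 :- x :* x) := (X :* Y) :+ (:- K 1) :* ((x :* (x :* X)) :* Y))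
           refl (x ^F k) x (y ^F l) ⟩
    monomialAt x y k l + (- 1#) * monomialAt x y (suc (suc k)) l
      ≈⟨ +-cong (monomialAt-reduce on k l) (*-congˡ (monomialAt-reduce on (suc (suc k)) l)) ⟩
    (A₁ + y * B₁) + (- 1#) * (A₂ + y * B₂)
      ≈⟨ solve 5 (λ y A₁ B₁ A₂ B₂ → (A₁ :+ y :* B₁) :+ (:- K 1) :* (A₂ :+ y :* B₂)
                                    := (A₁ :+ (:- K 1) :* A₂) :+ y :* (B₁ :+ (:- K 1) :* B₂))
           refl y A₁ B₁ A₂ B₂ ⟩
    (A₁ + (- 1#) * A₂) + y * (B₁ + (- 1#) * B₂)
      ≈⟨ sym (+-cong (evalU-⊖U (reduceᴬ k l) _ x) (*-congˡ (evalU-⊖U (reduceᴮ k l) _ x))) ⟩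
    evalU (reduceᴬ k (suc (suc l))) x + y * evalU (reduceᴮ k (suc (suc l))) x ∎
    where
    A₁ = evalU (reduceᴬ k l) x
    B₁ = evalU (reduceᴮ k l) x
    A₂ = evalU (reduceᴬ (suc (suc k)) l) x
    B₂ = evalU (reduceᴮ (suc (suc k)) l) x

  reduceₚᴬ reduceₚᴮ : Poly → UPoly
  reduceₚᴬ []                = []
  reduceₚᴬ ((a , k , l) ∷ p) = scaleU a (reduceᴬ k l) ⊕U reduceₚᴬ p
  reduceₚᴮ []                = []
  reduceₚᴮ ((a , k , l) ∷ p) = scaleU a (reduceᴮ k l) ⊕U reduceₚᴮ p

  ε-reduceₚ : ∀ {x y} → OnS¹ x y → ∀ p → ε p x y ≈ evalU (reduceₚᴬ p) x + y * evalU (reduceₚᴮ p) x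
  ε-reduceₚ {x} {y} on []                = sym (trans (+-identityˡ _) (zeroʳ y))
  ε-reduceₚ {x} {y} on ((a , k , l) ∷ p) = begin
    a * monomialAt x y k l + ε p x y     ≈⟨ +-cong (*-congˡ (monomialAt-reduce on k l)) (ε-reduceₚ on p) ⟩
    a * (A + y * B) + (A′ + y * B′)
      ≈⟨ solve 6 (λ a y A B A′ B′ → a :* (A :+ y :* B) :+ (A′ :+ y :* B′) := (a :* A :+ A′) :+ y :* (a :* B :+ B′))
           refl a y A B A′ B′ ⟩
    (a * A + A′) + y * (a * B + B′)
      ≈⟨ sym (+-cong (trans (evalU-⊕U (scaleU a (reduceᴬ k l)) (reduceₚᴬ p) x) (+-congʳ (evalU-scaleU a (reduceᴬ k l) x)))
                     (*-congˡ (trans (evalU-⊕U (scaleU a (reduceᴮ k l)) (reduceₚᴮ p) x) (+-congʳ (evalU-scaleU a (reduceᴮ k l) x))))) ⟩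
    evalU (reduceₚᴬ ((a , k , l) ∷ p)) x + y * evalU (reduceₚᴮ ((a , k , l) ∷ p)) x ∎
    where
    A  = evalU (reduceᴬ k l) x
    B  = evalU (reduceᴮ k l) x
    A′ = evalU (reduceₚᴬ p) x
    B′ = evalU (reduceₚᴮ p) x

  record IsCircleWeight (g : Weights) : Set ℓ where
    field
      circle      : ∀ k l → g k l ≈ g (suc (suc k)) l + g k (suc (suc l))
      α₂-vanishes : ∀ k → g k 1 ≈ 0#

    weight-reduce : ∀ k l → g k l ≈ weigh (λ i → g i 0) (reduceᴬ k l)
    weight-reduce k zero          = sym (weigh-xpow _ k)
    weight-reduce k (suc zero)    = α₂-vanishes k
    weight-reduce k (suc (suc l)) = begin
      g k (suc (suc l))
        ≈⟨ solve 2 (λ a b → b := (a :+ b) :+ (:- K 1) :* a) refl (g (suc (suc k)) l) (g k (suc (suc l))) ⟩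
      (g (suc (suc k)) l + g k (suc (suc l))) + (- 1#) * g (suc (suc k)) l
        ≈⟨ +-cong (sym (circle k l)) (*-congˡ (weight-reduce (suc (suc k)) l)) ⟩
      g k l + (- 1#) * weigh _ (reduceᴬ (suc (suc k)) l)
        ≈⟨ +-congʳ (weight-reduce k l) ⟩
      weigh _ (reduceᴬ k l) + (- 1#) * weigh _ (reduceᴬ (suc (suc k)) l)
        ≈⟨ sym (weigh-⊖U _ (reduceᴬ k l) _) ⟩
      weigh _ (reduceᴬ k (suc (suc l))) ∎

    extend-reduceₚ : ∀ p → extend g p ≈ weigh (λ i → g i 0) (reduceₚᴬ p)
    extend-reduceₚ []                = refl
    extend-reduceₚ ((a , k , l) ∷ p) =
      trans (+-cong (*-congˡ (weight-reduce k l)) (extend-reduceₚ p))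
        (sym (trans (weigh-⊕U _ (scaleU a (reduceᴬ k l)) (reduceₚᴬ p)) (+-congʳ (weigh-scaleU _ a (reduceᴬ k l)))))

  Σ< : ℕ → (ℕ → Carrier) → Carrier
  Σ< zero    f = 0#
  Σ< (suc n) f = Σ< n f + f n

  Σ<-cong : ∀ n {f h} → (∀ k → f k ≈ h k) → Σ< n f ≈ Σ< n h
  Σ<-cong zero    f≈h = refl
  Σ<-cong (suc n) f≈h = +-cong (Σ<-cong n f≈h) (f≈h n)

  Σ<-+ : ∀ n f h → Σ< n (λ k → f k + h k) ≈ Σ< n f + Σ< n h
  Σ<-+ zero    f h = sym (+-identityˡ 0#)
  Σ<-+ (suc n) f h = trans (+-congʳ (Σ<-+ n f h))
    (solve 4 (λ a b c d → (a :+ b) :+ (c :+ d) := (a :+ c) :+ (b :+ d)) refl _ _ _ _)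

  Σ<-zero : ∀ n f → (∀ k → k ℕ.< n → f k ≈ 0#) → Σ< n f ≈ 0#
  Σ<-zero zero    f f≈0 = refl
  Σ<-zero (suc n) f f≈0 =
    trans (+-cong (Σ<-zero n f (λ k k<n → f≈0 k (ℕP.m<n⇒m<1+n k<n))) (f≈0 n (ℕP.n<1+n n))) (+-identityˡ 0#)

  Σ<-single : ∀ n f i → i ℕ.< n → (∀ k → k ≢ i → f k ≈ 0#) → Σ< n f ≈ f i
  Σ<-single (suc n) f i i<1+n f≈0 with i ℕP.≟ n
  ... | yes ≡.refl = trans (+-congʳ (Σ<-zero n f (λ k k<i → f≈0 k (λ k≡i → ℕP.<-irrefl k≡i k<i)))) (+-identityˡ _)
  ... | no i≢n     = trans (+-cong (Σ<-single n f i (ℕP.≤∧≢⇒< (ℕP.≤-pred i<1+n) i≢n) f≈0)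
                                   (f≈0 n (λ n≡i → i≢n (≡.sym n≡i))))
                           (+-identityʳ _)

  coeffTerm-≢ˡ : ∀ k l a i j → k ≢ i → coeffTerm k l (a , i , j) ≈ 0#
  coeffTerm-≢ˡ k l a i j k≢i with k ℕ.≡ᵇ i in eq
  ... | false = refl
  ... | true  = ⊥-elim (k≢i (ℕP.≡ᵇ⇒≡ k i (≡.subst T (≡.sym eq) _)))

  coeffTerm-≢ʳ : ∀ k l a i j → l ≢ j → coeffTerm k l (a , i , j) ≈ 0#
  coeffTerm-≢ʳ k l a i j l≢j with k ℕ.≡ᵇ i | l ℕ.≡ᵇ j in eq
  ... | false | _     = refl
  ... | true  | false = refl
  ... | true  | true  = ⊥-elim (l≢j (ℕP.≡ᵇ⇒≡ l j (≡.subst T (≡.sym eq) _)))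

  coeffTerm-≡ : ∀ a i j → coeffTerm i j (a , i , j) ≈ a
  coeffTerm-≡ a i j with i ℕ.≡ᵇ i in eq₁ | j ℕ.≡ᵇ j in eq₂
  ... | true  | true  = refl
  ... | false | _     = ⊥-elim (≡.subst T eq₁ (ℕP.≡⇒≡ᵇ i i ≡.refl))
  ... | true  | false = ⊥-elim (≡.subst T eq₂ (ℕP.≡⇒≡ᵇ j j ≡.refl))

  ExponentsBelow : ℕ → Poly → Set c
  ExponentsBelow n = All (λ t → Lift c ((proj₁ (proj₂ t) ℕ.< n) × (proj₂ (proj₂ t) ℕ.< n)))

  exponentBound : Poly → ℕ
  exponentBound []                = 0
  exponentBound ((a , i , j) ∷ p) = suc i ℕ.⊔ suc j ℕ.⊔ exponentBound p

  ExponentsBelow-mono : ∀ {m n} p → m ℕ.≤ n → ExponentsBelow m p → ExponentsBelow n p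
  ExponentsBelow-mono []      m≤n []                        = []
  ExponentsBelow-mono (t ∷ p) m≤n (lift (i<m , j<m) ∷ below) =
    lift (ℕP.<-≤-trans i<m m≤n , ℕP.<-≤-trans j<m m≤n) ∷ ExponentsBelow-mono p m≤n below

  exponentsBelow-bound : ∀ p → ExponentsBelow (exponentBound p) p
  exponentsBelow-bound []                = []
  exponentsBelow-bound ((a , i , j) ∷ p) =
    lift (ℕP.m≤n⇒m≤n⊔o (exponentBound p) (ℕP.m≤m⊔n (suc i) (suc j)) ,
          ℕP.m≤n⇒m≤n⊔o (exponentBound p) (ℕP.m≤n⊔m (suc i) (suc j)))
    ∷ ExponentsBelow-mono p (ℕP.m≤n⊔m _ (exponentBound p)) (exponentsBelow-bound p)

  extendᶜ : ℕ → Weights → Poly → Carrier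
  extendᶜ n g p = Σ< n (λ k → Σ< n (λ l → coeff p k l * g k l))

  extendᶜ-term : ∀ n (g : Weights) a i j → i ℕ.< n → j ℕ.< n →
                 Σ< n (λ k → Σ< n (λ l → coeffTerm k l (a , i , j) * g k l)) ≈ a * g i j
  extendᶜ-term n g a i j i<n j<n = begin
    Σ< n (λ k → Σ< n (λ l → coeffTerm k l (a , i , j) * g k l))
      ≈⟨ Σ<-single n (λ k → Σ< n (λ l → coeffTerm k l (a , i , j) * g k l)) i i<n
           (λ k k≢i → Σ<-zero n _ (λ l _ → trans (*-congʳ (coeffTerm-≢ˡ k l a i j k≢i)) (zeroˡ _))) ⟩
    Σ< n (λ l → coeffTerm i l (a , i , j) * g i l)
      ≈⟨ Σ<-single n (λ l → coeffTerm i l (a , i , j) * g i l) j j<n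
           (λ l l≢j → trans (*-congʳ (coeffTerm-≢ʳ i l a i j l≢j)) (zeroˡ _)) ⟩
    coeffTerm i j (a , i , j) * g i j
      ≈⟨ *-congʳ (coeffTerm-≡ a i j) ⟩
    a * g i j ∎

  extend≈extendᶜ : ∀ n g p → ExponentsBelow n p → extend g p ≈ extendᶜ n g p
  extend≈extendᶜ n g []                _                        =
    sym (Σ<-zero n _ (λ k _ → Σ<-zero n _ (λ l _ → zeroˡ _)))
  extend≈extendᶜ n g ((a , i , j) ∷ p) (lift (i<n , j<n) ∷ below) = sym (begin
    Σ< n (λ k → Σ< n (λ l → (coeffTerm k l (a , i , j) + coeff p k l) * g k l))
      ≈⟨ Σ<-cong n (λ k → trans (Σ<-cong n (λ l → distribʳ _ _ _)) (Σ<-+ n _ _)) ⟩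
    Σ< n (λ k → Σ< n (λ l → coeffTerm k l (a , i , j) * g k l) + Σ< n (λ l → coeff p k l * g k l))
      ≈⟨ Σ<-+ n _ _ ⟩
    Σ< n (λ k → Σ< n (λ l → coeffTerm k l (a , i , j) * g k l)) + extendᶜ n g p
      ≈⟨ +-cong (extendᶜ-term n g a i j i<n j<n) (sym (extend≈extendᶜ n g p below)) ⟩
    a * g i j + extend g p ∎)

  extend-resp-≈ₚ : ∀ g {p q} → p ≈ₚ q → extend g p ≈ extend g q
  extend-resp-≈ₚ g {p} {q} p≈q = begin
    extend g p      ≈⟨ extend≈extendᶜ n g p (ExponentsBelow-mono p (ℕP.m≤m⊔n _ _) (exponentsBelow-bound p)) ⟩
    extendᶜ n g p   ≈⟨ Σ<-cong n (λ k → Σ<-cong n (λ l → *-congʳ (p≈q k l))) ⟩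
    extendᶜ n g q   ≈⟨ sym (extend≈extendᶜ n g q (ExponentsBelow-mono q (ℕP.m≤n⊔m _ _) (exponentsBelow-bound q))) ⟩
    extend g q      ∎
    where n = exponentBound p ℕ.⊔ exponentBound q

  cross-multiply : ∀ {x y z w} → ¬ (y ≈ 0#) → ¬ (w ≈ 0#) → x * w ≈ z * y → x * y ⁻¹ ≈ z * w ⁻¹
  cross-multiply {x} {y} {z} {w} y≉0 w≉0 xw≈zy = begin
    x * y ⁻¹                   ≈⟨ sym (trans (*-congˡ (⁻¹-inverseʳ w w≉0)) (*-identityʳ _)) ⟩
    (x * y ⁻¹) * (w * w ⁻¹)
      ≈⟨ solve 4 (λ x y′ w w′ → (x :* y′) :* (w :* w′) := ((x :* w) :* y′) :* w′) refl x (y ⁻¹) w (w ⁻¹) ⟩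
    ((x * w) * y ⁻¹) * w ⁻¹    ≈⟨ *-congʳ (*-congʳ xw≈zy) ⟩
    ((z * y) * y ⁻¹) * w ⁻¹
      ≈⟨ solve 4 (λ z y y′ w′ → ((z :* y) :* y′) :* w′ := (z :* w′) :* (y :* y′)) refl z y (y ⁻¹) (w ⁻¹) ⟩
    (z * w ⁻¹) * (y * y ⁻¹)    ≈⟨ trans (*-congˡ (⁻¹-inverseʳ y y≉0)) (*-identityʳ _) ⟩
    z * w ⁻¹                   ∎

module CharacteristicZero {c ℓ : Level} (F : Field c ℓ) (char0 : WithField.CharZero F) where
  open Field F hiding (zero)
  open WithField F
  open AnyField F
  open import Relation.Binary.Reasoning.Setoid setoid
  open import Algebra.Properties.Ring ring using (-0#≈0#; -‿involutive)

  ℕ→F≉0 : ∀ n → .{{ NonZero n }} → ¬ (ℕ→F n ≈ 0#)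
  ℕ→F≉0 (suc n) = char0 n

  2≉0 : ¬ (1# + 1# ≈ 0#)
  2≉0 2≈0 = char0 1 (trans (sym (lit≈ℕ→F 2)) 2≈0)

  private
    ℕ→F≈0⇒≡0 : ∀ d → ℕ→F d ≈ 0# → d ≡ 0
    ℕ→F≈0⇒≡0 zero    _   = ≡.refl
    ℕ→F≈0⇒≡0 (suc d) d≈0 = ⊥-elim (char0 d d≈0)

    ℕ→F-injective-≤ : ∀ {m n} → m ℕ.≤ n → ℕ→F m ≈ ℕ→F n → m ≡ n
    ℕ→F-injective-≤ {m} {n} m≤n m≈n =
      ≡.trans (≡.sym (ℕP.+-identityʳ m)) (≡.trans (≡.cong (m ℕ.+_) (≡.sym n∸m≡0)) (ℕP.m+[n∸m]≡n m≤n))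
      where
      n∸m≡0 : n ℕ.∸ m ≡ 0
      n∸m≡0 = ℕ→F≈0⇒≡0 _ (x≈x+y⇒y≈0 (ℕ→F m) _ (trans m≈n (trans
        (reflexive (≡.cong ℕ→F (≡.sym (ℕP.m+[n∸m]≡n m≤n)))) (ℕ→F-+ m (n ℕ.∸ m)))))

  ℕ→F-injective : ∀ {m n} → ℕ→F m ≈ ℕ→F n → m ≡ n
  ℕ→F-injective {m} {n} m≈n with ℕP.≤-total m n
  ... | inj₁ m≤n = ℕ→F-injective-≤ m≤n m≈n
  ... | inj₂ n≤m = ≡.sym (ℕ→F-injective-≤ n≤m (sym m≈n))

  Ω-den≉0 : ∀ m n → ¬ (ℕ→F (Ω-den m n) ≈ 0#)
  Ω-den≉0 m n = ℕ→F≉0 (Ω-den m n)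
    {{ ℕP.m*n≢0 _ _ {{ ℕP.m*n≢0 _ _ {{ ℕP.m*n≢0 _ _ {{ ℕP.m^n≢0 4 (m ℕ.+ n) }} {{ m ℕP.!≢0 }} }}
                                     {{ n ℕP.!≢0 }} }}
                    {{ (m ℕ.+ n) ℕP.!≢0 }} }}

  ΩF-ratio : ∀ a b m n m′ n′ → (a ℕ.* Ω-num m n) ℕ.* Ω-den m′ n′ ≡ (b ℕ.* Ω-num m′ n′) ℕ.* Ω-den m n →
             ℕ→F a * ΩF m n ≈ ℕ→F b * ΩF m′ n′
  ΩF-ratio a b m n m′ n′ eq = begin
    ℕ→F a * ΩF m n                                       ≈⟨ scaled a m n ⟩
    ℕ→F (a ℕ.* Ω-num m n) * ℕ→F (Ω-den m n) ⁻¹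
      ≈⟨ cross-multiply (Ω-den≉0 m n) (Ω-den≉0 m′ n′)
           (trans (sym (ℕ→F-* (a ℕ.* Ω-num m n) (Ω-den m′ n′)))
             (trans (reflexive (≡.cong ℕ→F eq)) (ℕ→F-* (b ℕ.* Ω-num m′ n′) (Ω-den m n)))) ⟩
    ℕ→F (b ℕ.* Ω-num m′ n′) * ℕ→F (Ω-den m′ n′) ⁻¹        ≈⟨ sym (scaled b m′ n′) ⟩
    ℕ→F b * ΩF m′ n′                                     ∎
    where
    scaled : ∀ a m n → ℕ→F a * ΩF m n ≈ ℕ→F (a ℕ.* Ω-num m n) * ℕ→F (Ω-den m n) ⁻¹
    scaled a m n = trans (sym (*-assoc _ _ _)) (*-congʳ (sym (ℕ→F-* a _)))

  ΩF-sucˡ : ∀ m n → ℕ→F (2 ℕ.* suc (m ℕ.+ n)) * ΩF (suc m) n ≈ ℕ→F (suc (m ℕ.+ m)) * ΩF m n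
  ΩF-sucˡ m n = ΩF-ratio (2 ℕ.* suc (m ℕ.+ n)) (suc (m ℕ.+ m)) (suc m) n m n eq
    where
    [2m+2]! : (2 ℕ.* suc m) ! ≡ suc (suc (2 ℕ.* m)) ℕ.* (suc (2 ℕ.* m) ℕ.* (2 ℕ.* m) !)
    [2m+2]! = ≡.cong _! (ℕP.*-suc 2 m)
    identity : ∀ m n A B P₄ Fm Fn Fmn →
      ((2 ℕ.* suc (m ℕ.+ n)) ℕ.* ((suc (suc (2 ℕ.* m)) ℕ.* (suc (2 ℕ.* m) ℕ.* A)) ℕ.* B)) ℕ.* (P₄ ℕ.* Fm ℕ.* Fn ℕ.* Fmn)
      ≡ (suc (m ℕ.+ m) ℕ.* (A ℕ.* B)) ℕ.* ((4 ℕ.* P₄) ℕ.* (suc m ℕ.* Fm) ℕ.* Fn ℕ.* (suc (m ℕ.+ n) ℕ.* Fmn))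
    identity = solve-∀
    eq : (2 ℕ.* suc (m ℕ.+ n) ℕ.* Ω-num (suc m) n) ℕ.* Ω-den m n ≡ (suc (m ℕ.+ m) ℕ.* Ω-num m n) ℕ.* Ω-den (suc m) n
    eq rewrite [2m+2]! = identity m n ((2 ℕ.* m) !) ((2 ℕ.* n) !) (4 ℕ.^ (m ℕ.+ n)) (m !) (n !) ((m ℕ.+ n) !)

  ΩF-sym : ∀ m n → ΩF m n ≡ ΩF n m
  ΩF-sym m n = ≡.cong₂ (λ a b → ℕ→F a * ℕ→F b ⁻¹) (ℕP.*-comm ((2 ℕ.* m) !) ((2 ℕ.* n) !)) den-sym
    where
    swap : ∀ a b c d → a ℕ.* b ℕ.* c ℕ.* d ≡ a ℕ.* c ℕ.* b ℕ.* d
    swap = solve-∀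
    den-sym : Ω-den m n ≡ Ω-den n m
    den-sym rewrite ℕP.+-comm m n = swap (4 ℕ.^ (n ℕ.+ m)) (m !) (n !) ((n ℕ.+ m) !)

  ΩF-sucʳ : ∀ m n → ℕ→F (2 ℕ.* suc (m ℕ.+ n)) * ΩF m (suc n) ≈ ℕ→F (suc (n ℕ.+ n)) * ΩF m n
  ΩF-sucʳ m n rewrite ΩF-sym m (suc n) | ΩF-sym m n | ℕP.+-comm m n = ΩF-sucˡ n m

  ΩF-circle : ∀ m n → ΩF m n ≈ ΩF (suc m) n + ΩF m (suc n)
  ΩF-circle m n = *-cancelˡ (ℕ→F 2[m+n+1]) (ℕ→F≉0 2[m+n+1]) (sym (begin
    ℕ→F 2[m+n+1] * (ΩF (suc m) n + ΩF m (suc n))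
      ≈⟨ trans (distribˡ _ _ _) (+-cong (ΩF-sucˡ m n) (ΩF-sucʳ m n)) ⟩
    ℕ→F (suc (m ℕ.+ m)) * ΩF m n + ℕ→F (suc (n ℕ.+ n)) * ΩF m n
      ≈⟨ sym (distribʳ _ _ _) ⟩
    (ℕ→F (suc (m ℕ.+ m)) + ℕ→F (suc (n ℕ.+ n))) * ΩF m n
      ≈⟨ *-congʳ (trans (sym (ℕ→F-+ (suc (m ℕ.+ m)) _)) (reflexive (≡.cong ℕ→F (sum m n)))) ⟩
    ℕ→F 2[m+n+1] * ΩF m n ∎))
    where
    2[m+n+1] = 2 ℕ.* suc (m ℕ.+ n)
    sum : ∀ m n → suc (m ℕ.+ m) ℕ.+ suc (n ℕ.+ n) ≡ 2 ℕ.* suc (m ℕ.+ n)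
    sum = solve-∀

  ΩF-rotation : ∀ m n → ℕ→F (suc (m ℕ.+ m)) * ΩF m (suc n) ≈ ℕ→F (suc (n ℕ.+ n)) * ΩF (suc m) n
  ΩF-rotation m n = *-cancelˡ κ (ℕ→F≉0 (2 ℕ.* suc (m ℕ.+ n))) (begin
    κ * (a * ΩF m (suc n))     ≈⟨ x*[y*z]≈y*[x*z] κ a _ ⟩
    a * (κ * ΩF m (suc n))     ≈⟨ *-congˡ (ΩF-sucʳ m n) ⟩
    a * (b * ΩF m n)           ≈⟨ x*[y*z]≈y*[x*z] a b _ ⟩
    b * (a * ΩF m n)           ≈⟨ *-congˡ (sym (ΩF-sucˡ m n)) ⟩
    b * (κ * ΩF (suc m) n)     ≈⟨ x*[y*z]≈y*[x*z] b κ _ ⟩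
    κ * (b * ΩF (suc m) n)     ∎)
    where
    κ = ℕ→F (2 ℕ.* suc (m ℕ.+ n))
    a = ℕ→F (suc (m ℕ.+ m))
    b = ℕ→F (suc (n ℕ.+ n))
    x*[y*z]≈y*[x*z] : ∀ x y z → x * (y * z) ≈ y * (x * z)
    x*[y*z]≈y*[x*z] = solve 3 (λ x y z → x :* (y :* z) := y :* (x :* z)) refl

  half≡just⇒double : ∀ k {m} → half k ≡ just m → k ≡ m ℕ.+ m
  half≡just⇒double zero          ≡.refl = ≡.refl
  half≡just⇒double (suc (suc k)) eq with half k in eqₖ
  half≡just⇒double (suc (suc k)) ≡.refl | just m =
    ≡.cong suc (≡.trans (≡.cong suc (half≡just⇒double k eqₖ)) (≡.sym (ℕP.+-suc m m)))

  ψ-mono-even : ∀ k l {m n} → half k ≡ just m → half l ≡ just n → ψ-mono k l ≡ ΩF m n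
  ψ-mono-even k l eqₖ eqₗ with half k | half l | eqₖ | eqₗ
  ... | _ | _ | ≡.refl | ≡.refl = ≡.refl

  ψ-mono-oddˡ : ∀ k l → half k ≡ nothing → ψ-mono k l ≡ 0#
  ψ-mono-oddˡ k l eq with half k | eq
  ... | _ | ≡.refl = ≡.refl

  ψ-mono-oddʳ : ∀ k l → half l ≡ nothing → ψ-mono k l ≡ 0#
  ψ-mono-oddʳ k l eq with half k | half l | eq
  ... | just _  | _ | ≡.refl = ≡.refl
  ... | nothing | _ | _      = ≡.refl

  ψ-mono-circle : ∀ k l → ψ-mono k l ≈ ψ-mono (suc (suc k)) l + ψ-mono k (suc (suc l))
  ψ-mono-circle k l = cases (half k) (half l) ≡.refl ≡.refl
    where
    cases : ∀ hk hl → half k ≡ hk → half l ≡ hl → ψ-mono k l ≈ ψ-mono (suc (suc k)) l + ψ-mono k (suc (suc l))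
    cases (just m) (just n) eqₖ eqₗ = begin
      ψ-mono k l                                       ≡⟨ ψ-mono-even k l eqₖ eqₗ ⟩
      ΩF m n                                           ≈⟨ ΩF-circle m n ⟩
      ΩF (suc m) n + ΩF m (suc n)
        ≡⟨ ≡.sym (≡.cong₂ _+_ (ψ-mono-even (suc (suc k)) l (≡.cong (Maybe.map suc) eqₖ) eqₗ)
                               (ψ-mono-even k (suc (suc l)) eqₖ (≡.cong (Maybe.map suc) eqₗ))) ⟩
      ψ-mono (suc (suc k)) l + ψ-mono k (suc (suc l))   ∎
    cases nothing _ eqₖ _ = trans (reflexive (ψ-mono-oddˡ k l eqₖ)) (sym (trans
      (+-cong (reflexive (ψ-mono-oddˡ (suc (suc k)) l (≡.cong (Maybe.map suc) eqₖ))) (reflexive (ψ-mono-oddˡ k (suc (suc l)) eqₖ)))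
      (+-identityˡ 0#)))
    cases (just m) nothing eqₖ eqₗ = trans (reflexive (ψ-mono-oddʳ k l eqₗ)) (sym (trans
      (+-cong (reflexive (ψ-mono-oddʳ (suc (suc k)) l eqₗ)) (reflexive (ψ-mono-oddʳ k (suc (suc l)) (≡.cong (Maybe.map suc) eqₗ))))
      (+-identityˡ 0#)))

  ψ-mono-isCircleWeight : IsCircleWeight ψ-mono
  ψ-mono-isCircleWeight = record { circle = ψ-mono-circle ; α₂-vanishes = λ k → reflexive (ψ-mono-oddʳ k 1 ≡.refl) }

  -- extend (derive g) p = extend g (X p) for the rotation field
  -- X = α₂ ∂₁ − α₁ ∂₂; X (α₁ + i α₂)ʲ = −i j (α₁ + i α₂)ʲ.
  derive : Weights → Weights
  derive g k l = ℕ→F k * g (k ℕ.∸ 1) (suc l) - ℕ→F l * g (suc k) (l ℕ.∸ 1)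

  extend-α₁*ₚ : ∀ g q → extend g (α₁ *ₚ q) ≈ extend (shift 1 0 g) q
  extend-α₁*ₚ g q = trans (extend-term-*ₚ g 1# 1 0 q) (*-identityˡ _)

  extend-α₂*ₚ : ∀ g q → extend g (α₂ *ₚ q) ≈ extend (shift 0 1 g) q
  extend-α₂*ₚ g q = trans (extend-term-*ₚ g 1# 0 1 q) (*-identityˡ _)

  derive-α₁*ₚ : ∀ g q → extend (derive g) (α₁ *ₚ q) ≈ extend (shift 0 1 g) q + extend (derive (shift 1 0 g)) q
  derive-α₁*ₚ g q =
    trans (extend-α₁*ₚ (derive g) q) (trans (extend-cong leibniz q) (extend-+ (shift 0 1 g) _ q))
    where
    k*g≈k*g : ∀ k l → ℕ→F k * g k (suc l) ≈ ℕ→F k * g (suc (k ℕ.∸ 1)) (suc l)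
    k*g≈k*g zero    l = trans (zeroˡ _) (sym (zeroˡ _))
    k*g≈k*g (suc k) l = refl
    leibniz : ∀ k l → shift 1 0 (derive g) k l ≈ shift 0 1 g k l + derive (shift 1 0 g) k l
    leibniz k l = trans (+-congʳ (trans (distribʳ _ 1# (ℕ→F k)) (+-cong (*-identityˡ _) (k*g≈k*g k l))))
      (+-assoc _ _ _)

  derive-α₂*ₚ : ∀ g q → extend (derive g) (α₂ *ₚ q) ≈ (- 1#) * extend (shift 1 0 g) q + extend (derive (shift 0 1 g)) q
  derive-α₂*ₚ g q =
    trans (extend-α₂*ₚ (derive g) q) (trans (extend-cong leibniz q)
      (trans (extend-+ (λ k l → (- 1#) * shift 1 0 g k l) _ q) (+-congʳ (extend-* (shift 1 0 g) (- 1#) q))))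
    where
    l*g≈l*g : ∀ k l → ℕ→F l * g (suc k) l ≈ ℕ→F l * g (suc k) (suc (l ℕ.∸ 1))
    l*g≈l*g k zero    = trans (zeroˡ _) (sym (zeroˡ _))
    l*g≈l*g k (suc l) = refl
    leibniz : ∀ k l → shift 0 1 (derive g) k l ≈ (- 1#) * shift 1 0 g k l + derive (shift 0 1 g) k l
    leibniz k l = begin
      ℕ→F k * g (k ℕ.∸ 1) (suc (suc l)) - (1# + ℕ→F l) * g (suc k) l
        ≈⟨ +-congˡ (-‿cong (trans (distribʳ _ 1# (ℕ→F l)) (+-congˡ (l*g≈l*g k l)))) ⟩
      ℕ→F k * g (k ℕ.∸ 1) (suc (suc l)) - (1# * g (suc k) l + ℕ→F l * g (suc k) (suc (l ℕ.∸ 1)))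
        ≈⟨ solve 3 (λ A G B → A :- (K 1 :* G :+ B) := (:- K 1) :* G :+ (A :- B)) refl _ _ _ ⟩
      (- 1#) * g (suc k) l + derive (shift 0 1 g) k l ∎

  derive-P×Q : ∀ j g → (extend (derive g) (P j) ≈ ℕ→F j * extend g (Q j))
                     × (extend (derive g) (Q j) ≈ - (ℕ→F j * extend g (P j)))
  derive-P×Q zero    g = solve 2 (λ a b → K 1 :* (K 0 :* a :- K 0 :* b) :+ K 0 := K 0 :* K 0) refl (g 0 1) (g 1 0)
                       , solve 1 (λ a → K 0 := :- (K 0 :* a)) refl (extend g 𝟏)
  derive-P×Q (suc j) g = derive-P , derive-Q
    where
    a = extend (shift 0 1 g) (P j)
    b = extend (shift 1 0 g) (Q j)
    c′ = extend (shift 1 0 g) (P j)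
    d = extend (shift 0 1 g) (Q j)
    n = ℕ→F j
    derive-P : extend (derive g) (P (suc j)) ≈ ℕ→F (suc j) * extend g (Q (suc j))
    derive-P = begin
      extend (derive g) ((α₁ *ₚ P j) ++ ((- 1#) ·ₚ (α₂ *ₚ Q j)))
        ≈⟨ extend-++ _ (α₁ *ₚ P j) _ ⟩
      extend (derive g) (α₁ *ₚ P j) + extend (derive g) ((- 1#) ·ₚ (α₂ *ₚ Q j))
        ≈⟨ +-cong (derive-α₁*ₚ g (P j)) (trans (extend-·ₚ _ (- 1#) (α₂ *ₚ Q j)) (*-congˡ (derive-α₂*ₚ g (Q j)))) ⟩
      (a + extend (derive (shift 1 0 g)) (P j)) + (- 1#) * ((- 1#) * b + extend (derive (shift 0 1 g)) (Q j))
        ≈⟨ +-cong (+-congˡ (proj₁ (derive-P×Q j (shift 1 0 g)))) (*-congˡ (+-congˡ (proj₂ (derive-P×Q j (shift 0 1 g))))) ⟩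
      (a + n * b) + (- 1#) * ((- 1#) * b + - (n * a))
        ≈⟨ solve 3 (λ a b n → (a :+ n :* b) :+ (:- K 1) :* ((:- K 1) :* b :+ :- (n :* a)) := (K 1 :+ n) :* (a :+ b)) refl a b n ⟩
      (1# + n) * (a + b)
        ≈⟨ *-congˡ (sym (trans (extend-++ g (α₂ *ₚ P j) (α₁ *ₚ Q j)) (+-cong (extend-α₂*ₚ g (P j)) (extend-α₁*ₚ g (Q j))))) ⟩
      ℕ→F (suc j) * extend g (Q (suc j)) ∎
    derive-Q : extend (derive g) (Q (suc j)) ≈ - (ℕ→F (suc j) * extend g (P (suc j)))
    derive-Q = begin
      extend (derive g) ((α₂ *ₚ P j) ++ (α₁ *ₚ Q j))
        ≈⟨ extend-++ _ (α₂ *ₚ P j) _ ⟩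
      extend (derive g) (α₂ *ₚ P j) + extend (derive g) (α₁ *ₚ Q j)
        ≈⟨ +-cong (derive-α₂*ₚ g (P j)) (derive-α₁*ₚ g (Q j)) ⟩
      ((- 1#) * c′ + extend (derive (shift 0 1 g)) (P j)) + (d + extend (derive (shift 1 0 g)) (Q j))
        ≈⟨ +-cong (+-congˡ (proj₁ (derive-P×Q j (shift 0 1 g)))) (+-congˡ (proj₂ (derive-P×Q j (shift 1 0 g)))) ⟩
      ((- 1#) * c′ + n * d) + (d + - (n * c′))
        ≈⟨ solve 3 (λ c d n → ((:- K 1) :* c :+ n :* d) :+ (d :+ :- (n :* c)) := :- ((K 1 :+ n) :* (c :+ (:- K 1) :* d))) refl c′ d n ⟩
      - ((1# + n) * (c′ + (- 1#) * d))
        ≈⟨ -‿cong (*-congˡ (sym (trans (extend-++ g (α₁ *ₚ P j) ((- 1#) ·ₚ (α₂ *ₚ Q j)))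
             (+-cong (extend-α₁*ₚ g (P j)) (trans (extend-·ₚ g (- 1#) (α₂ *ₚ Q j)) (*-congˡ (extend-α₂*ₚ g (Q j)))))))) ⟩
      - (ℕ→F (suc j) * extend g (P (suc j))) ∎

  derive≈0⇒harmonics≈0 : ∀ {g} → (∀ k l → derive g k l ≈ 0#) → ∀ j →
                         (extend g (P (suc j)) ≈ 0#) × (extend g (Q (suc j)) ≈ 0#)
  derive≈0⇒harmonics≈0 {g} Xg≈0 j =
    a*x≈0⇒x≈0 (ℕ→F (suc j)) (char0 j) (begin
      ℕ→F (suc j) * extend g (P (suc j))       ≈⟨ sym (-‿involutive _) ⟩
      - - (ℕ→F (suc j) * extend g (P (suc j)))  ≈⟨ -‿cong (sym (proj₂ (derive-P×Q (suc j) g))) ⟩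
      - extend (derive g) (Q (suc j))           ≈⟨ -‿cong (extend-zero Xg≈0 (Q (suc j))) ⟩
      - 0#                                      ≈⟨ -0#≈0# ⟩
      0#                                        ∎) ,
    a*x≈0⇒x≈0 (ℕ→F (suc j)) (char0 j)
      (trans (sym (proj₁ (derive-P×Q (suc j) g))) (extend-zero Xg≈0 (P (suc j))))

  derive-ψ-mono≈0 : ∀ k l → derive ψ-mono k l ≈ 0#
  derive-ψ-mono≈0 zero l =
    trans (+-cong (zeroˡ _) (-‿cong (trans (*-congˡ (reflexive (ψ-mono-oddˡ 1 (l ℕ.∸ 1) ≡.refl))) (zeroʳ _))))
      (solve 0 (K 0 :+ (:- K 0) := K 0) refl)
  derive-ψ-mono≈0 (suc k) zero =
    trans (+-cong (trans (*-congˡ (reflexive (ψ-mono-oddʳ k 1 ≡.refl))) (zeroʳ _)) (-‿cong (zeroˡ _)))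
      (solve 0 (K 0 :+ (:- K 0) := K 0) refl)
  derive-ψ-mono≈0 (suc k) (suc l) = cases (half k) (half l) ≡.refl ≡.refl
    where
    a*0-b*0≈0 : ∀ a b → a * 0# - b * 0# ≈ 0#
    a*0-b*0≈0 = solve 2 (λ a b → a :* K 0 :- b :* K 0 := K 0) refl
    cases : ∀ hk hl → half k ≡ hk → half l ≡ hl → derive ψ-mono (suc k) (suc l) ≈ 0#
    cases (just m) (just n) eqₖ eqₗ = begin
      ℕ→F (suc k) * ψ-mono k (suc (suc l)) - ℕ→F (suc l) * ψ-mono (suc (suc k)) l
        ≡⟨ ≡.cong₂ _-_
             (≡.cong₂ _*_ (≡.cong (λ t → ℕ→F (suc t)) (half≡just⇒double k eqₖ))
                          (ψ-mono-even k (suc (suc l)) eqₖ (≡.cong (Maybe.map suc) eqₗ)))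
             (≡.cong₂ _*_ (≡.cong (λ t → ℕ→F (suc t)) (half≡just⇒double l eqₗ))
                          (ψ-mono-even (suc (suc k)) l (≡.cong (Maybe.map suc) eqₖ) eqₗ)) ⟩
      ℕ→F (suc (m ℕ.+ m)) * ΩF m (suc n) - ℕ→F (suc (n ℕ.+ n)) * ΩF (suc m) n
        ≈⟨ +-congʳ (ΩF-rotation m n) ⟩
      ℕ→F (suc (n ℕ.+ n)) * ΩF (suc m) n - ℕ→F (suc (n ℕ.+ n)) * ΩF (suc m) n
        ≈⟨ -‿inverseʳ _ ⟩
      0# ∎
    cases nothing _ eqₖ _ = trans
      (+-cong (*-congˡ (reflexive (ψ-mono-oddˡ k (suc (suc l)) eqₖ)))
              (-‿cong (*-congˡ (reflexive (ψ-mono-oddˡ (suc (suc k)) l (≡.cong (Maybe.map suc) eqₖ))))))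
      (a*0-b*0≈0 _ _)
    cases (just m) nothing eqₖ eqₗ = trans
      (+-cong (*-congˡ (reflexive (ψ-mono-oddʳ k (suc (suc l)) (≡.cong (Maybe.map suc) eqₗ))))
              (-‿cong (*-congˡ (reflexive (ψ-mono-oddʳ (suc (suc k)) l eqₗ)))))
      (a*0-b*0≈0 _ _)

  circleX circleY : ℕ → Carrier
  circleX t = (1# - ℕ→F (t ℕ.* t)) * (1# + ℕ→F (t ℕ.* t)) ⁻¹
  circleY t = ((1# + 1#) * ℕ→F t) * (1# + ℕ→F (t ℕ.* t)) ⁻¹

  1+t²≉0 : ∀ t → ¬ (1# + ℕ→F (t ℕ.* t) ≈ 0#)
  1+t²≉0 t = char0 (t ℕ.* t)

  circle-OnS¹ : ∀ t → OnS¹ (circleX t) (circleY t)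
  circle-OnS¹ t = begin
    circleX t * circleX t + circleY t * circleY t
      ≈⟨ solve 4 (λ τ n d i → ((K 1 :- τ) :* i) :* ((K 1 :- τ) :* i) :+ ((K 2 :* n) :* i) :* ((K 2 :* n) :* i)
                   := ((K 1 :- τ) :* (K 1 :- τ) :+ (K 2 :* n) :* (K 2 :* n)) :* (i :* i)) refl τ (ℕ→F t) D i ⟩
    ((1# - τ) * (1# - τ) + ((1# + 1#) * ℕ→F t) * ((1# + 1#) * ℕ→F t)) * (i * i)
      ≈⟨ *-congʳ (trans (+-congʳ (*-cong (+-congˡ (-‿cong τ≈t*t)) (+-congˡ (-‿cong τ≈t*t))))
           (solve 1 (λ n → (K 1 :- n :* n) :* (K 1 :- n :* n) :+ (K 2 :* n) :* (K 2 :* n) := (K 1 :+ n :* n) :* (K 1 :+ n :* n))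
              refl (ℕ→F t))) ⟩
    ((1# + ℕ→F t * ℕ→F t) * (1# + ℕ→F t * ℕ→F t)) * (i * i)
      ≈⟨ *-congʳ (sym (*-cong (+-congˡ τ≈t*t) (+-congˡ τ≈t*t))) ⟩
    (D * D) * (i * i)   ≈⟨ solve 2 (λ d i → (d :* d) :* (i :* i) := (d :* i) :* (d :* i)) refl D i ⟩
    (D * i) * (D * i)   ≈⟨ *-cong (⁻¹-inverseʳ D (1+t²≉0 t)) (⁻¹-inverseʳ D (1+t²≉0 t)) ⟩
    1# * 1#             ≈⟨ *-identityˡ 1# ⟩
    1#                  ∎
    where
    τ = ℕ→F (t ℕ.* t)
    D = 1# + τ
    i = D ⁻¹
    τ≈t*t : τ ≈ ℕ→F t * ℕ→F t
    τ≈t*t = ℕ→F-* t t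

  circle-OnS¹⁻ : ∀ t → OnS¹ (circleX t) (- circleY t)
  circle-OnS¹⁻ t = trans (+-congˡ (solve 1 (λ y → (:- y) :* (:- y) := y :* y) refl (circleY t))) (circle-OnS¹ t)

  circleX-injective : Injective circleX
  circleX-injective s t s≢t xₛ≈xₜ = s≢t (square-injective (ℕ→F-injective τₛ≈τₜ))
    where
    τ : ℕ → Carrier
    τ u = ℕ→F (u ℕ.* u)
    square-injective : ∀ {s t} → s ℕ.* s ≡ t ℕ.* t → s ≡ t
    square-injective {s} {t} eq with ℕP.<-cmp s t
    ... | tri< s<t _ _ = ⊥-elim (ℕP.<-irrefl eq (ℕP.*-mono-< s<t s<t))
    ... | tri≈ _ s≡t _ = s≡t
    ... | tri> _ _ t<s = ⊥-elim (ℕP.<-irrefl (≡.sym eq) (ℕP.*-mono-< t<s t<s))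
    x*[1+τ]≈1-τ : ∀ u → circleX u * (1# + τ u) ≈ 1# - τ u
    x*[1+τ]≈1-τ u = trans (*-assoc _ _ _)
      (trans (*-congˡ (trans (*-comm _ _) (⁻¹-inverseʳ _ (1+t²≉0 u)))) (*-identityʳ _))
    cross : (1# - τ s) * (1# + τ t) ≈ (1# - τ t) * (1# + τ s)
    cross = begin
      (1# - τ s) * (1# + τ t)                  ≈⟨ *-congʳ (sym (x*[1+τ]≈1-τ s)) ⟩
      (circleX s * (1# + τ s)) * (1# + τ t)    ≈⟨ *-congʳ (*-congʳ xₛ≈xₜ) ⟩
      (circleX t * (1# + τ s)) * (1# + τ t)
        ≈⟨ solve 3 (λ x a b → (x :* a) :* b := (x :* b) :* a) refl (circleX t) (1# + τ s) (1# + τ t) ⟩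
      (circleX t * (1# + τ t)) * (1# + τ s)    ≈⟨ *-congʳ (x*[1+τ]≈1-τ t) ⟩
      (1# - τ t) * (1# + τ s)                  ∎
    τₛ≈τₜ : τ s ≈ τ t
    τₛ≈τₜ = x+x≈y+y⇒x≈y 2≉0 (begin
      τ s + τ s
        ≈⟨ solve 2 (λ S τ → S :+ S := ((K 1 :- τ) :* (K 1 :+ S) :+ (:- K 1) :* ((K 1 :- S) :* (K 1 :+ τ))) :+ (τ :+ τ))
             refl (τ s) (τ t) ⟩
      ((1# - τ t) * (1# + τ s) + (- 1#) * ((1# - τ s) * (1# + τ t))) + (τ t + τ t)
        ≈⟨ +-congʳ (+-congˡ (*-congˡ cross)) ⟩
      ((1# - τ t) * (1# + τ s) + (- 1#) * ((1# - τ t) * (1# + τ s))) + (τ t + τ t)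
        ≈⟨ solve 2 (λ a τ → (a :+ (:- K 1) :* a) :+ (τ :+ τ) := τ :+ τ) refl ((1# - τ t) * (1# + τ s)) (τ t) ⟩
      τ t + τ t ∎)

  -- A vanishing p has A(x) ± y B(x) = 0 at (x , ±y) ∈ S¹, hence A(x) = 0 at
  -- infinitely many x, hence A = 0.
  circleWeight-local : ∀ {g} → IsCircleWeight g → ∀ p →
                       (∀ x y → OnS¹ x y → ε p x y ≈ 0#) → extend g p ≈ 0#
  circleWeight-local {g} isCircle p p≈0 =
    trans (IsCircleWeight.extend-reduceₚ isCircle p)
      (weigh-zero _ (reduceₚᴬ p) (infinitelyManyRoots⇒≈0 circleX circleX-injective (reduceₚᴬ p) A≈0))
    where
    A≈0 : ∀ t → evalU (reduceₚᴬ p) (circleX t) ≈ 0#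
    A≈0 t = x+x≈y+y⇒x≈y 2≉0 (begin
      A + A                               ≈⟨ solve 3 (λ A y B → A :+ A := (A :+ y :* B) :+ (A :+ (:- y) :* B)) refl A y B ⟩
      (A + y * B) + (A + (- y) * B)
        ≈⟨ +-cong (trans (sym (ε-reduceₚ (circle-OnS¹ t) p)) (p≈0 _ _ (circle-OnS¹ t)))
                  (trans (sym (ε-reduceₚ (circle-OnS¹⁻ t) p)) (p≈0 _ _ (circle-OnS¹⁻ t))) ⟩
      0# + 0#                             ∎)
      where
      y = circleY t
      A = evalU (reduceₚᴬ p) (circleX t)
      B = evalU (reduceₚᴮ p) (circleX t)

  ψ-isLocalLinear : IsLocalLinear ψ
  ψ-isLocalLinear = record
    { φ-++    = λ p q → ψ-via-extend (p ++ q) (trans (extend-++ ψ-mono p q) (sym (+-cong (≡ψ p) (≡ψ q))))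
    ; φ-·ₚ    = λ a p → ψ-via-extend (a ·ₚ p) (trans (extend-·ₚ ψ-mono a p) (*-congˡ (sym (≡ψ p))))
    ; φ-local = λ p p≈0 → ψ-via-extend p (circleWeight-local ψ-mono-isCircleWeight p p≈0)
    }
    where
    ≡ψ : ∀ p → ψ p ≈ extend ψ-mono p
    ≡ψ p = reflexive (ψ≡extend p)
    ψ-via-extend : ∀ p {v} → extend ψ-mono p ≈ v → ψ p ≈ v
    ψ-via-extend p eq = trans (≡ψ p) eq

  ψ-𝟏 : ψ 𝟏 ≈ 1#
  ψ-𝟏 = trans (+-identityʳ _) (trans (*-identityˡ _) (⁻¹-inverseʳ (ℕ→F 1) (char0 0)))

  ψ-isHarmonicAverage : IsHarmonicAverage ψ
  ψ-isHarmonicAverage = record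
    { localLinear = ψ-isLocalLinear
    ; φ-𝟏         = ψ-𝟏
    ; φ-P         = λ j → trans (reflexive (ψ≡extend (P (suc j)))) (proj₁ (derive≈0⇒harmonics≈0 derive-ψ-mono≈0 j))
    ; φ-Q         = λ j → trans (reflexive (ψ≡extend (Q (suc j)))) (proj₂ (derive≈0⇒harmonics≈0 derive-ψ-mono≈0 j))
    }

  5≉0 : ¬ (lit 5 ≈ 0#)
  5≉0 5≈0 = char0 4 (trans (sym (lit≈ℕ→F 5)) 5≈0)

  cos₀ sin₀ : Carrier
  cos₀ = lit 3 * lit 5 ⁻¹
  sin₀ = lit 4 * lit 5 ⁻¹

  cos₀²+sin₀²≈1 : cos₀ * cos₀ + sin₀ * sin₀ ≈ 1#
  cos₀²+sin₀²≈1 = begin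
    cos₀ * cos₀ + sin₀ * sin₀
      ≈⟨ solve 1 (λ i → (K 3 :* i) :* (K 3 :* i) :+ (K 4 :* i) :* (K 4 :* i) := (K 5 :* i) :* (K 5 :* i)) refl (lit 5 ⁻¹) ⟩
    (lit 5 * lit 5 ⁻¹) * (lit 5 * lit 5 ⁻¹) ≈⟨ *-cong (⁻¹-inverseʳ _ 5≉0) (⁻¹-inverseʳ _ 5≉0) ⟩
    1# * 1#                                 ≈⟨ *-identityˡ 1# ⟩
    1#                                      ∎

  -- 5ʲ⁺¹ cosₙ cos₀ sin₀ (j + 1) = (5a + 3) − 5b and 5ʲ⁺¹ sinₙ cos₀ sin₀ (j + 1) = (5c + 4) − 5d
  -- for (a , b , c , d) = residues j: the Gaussian integer (3 + 4i)ʲ⁺¹ is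
  -- congruent to 3 + 4i modulo 5, so cosₙ is never 1.
  residues : ℕ → ℕ × ℕ × ℕ × ℕ
  residues zero    = (0 , 0 , 0 , 0)
  residues (suc j) with residues j
  ... | (a , b , c , d) =
    (3 ℕ.* a ℕ.+ 4 ℕ.* d , 3 ℕ.* b ℕ.+ 4 ℕ.* c ℕ.+ 2 , 4 ℕ.* a ℕ.+ 3 ℕ.* c ℕ.+ 4 , 4 ℕ.* b ℕ.+ 3 ℕ.* d)

  cosNum sinNum : ℕ × ℕ × ℕ × ℕ → Carrier
  cosNum (a , b , c , d) = ℕ→F (5 ℕ.* a ℕ.+ 3) - ℕ→F (5 ℕ.* b)
  sinNum (a , b , c , d) = ℕ→F (5 ℕ.* c ℕ.+ 4) - ℕ→F (5 ℕ.* d)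

  private
    lit*ℕ→F : ∀ k n → lit k * ℕ→F n ≈ ℕ→F (k ℕ.* n)
    lit*ℕ→F k n = trans (*-congʳ (lit≈ℕ→F k)) (sym (ℕ→F-* k n))

    combine : ∀ p q A B C D →
      lit p * (ℕ→F A - ℕ→F B) + lit q * (ℕ→F C - ℕ→F D) ≈ ℕ→F (p ℕ.* A ℕ.+ q ℕ.* C) - ℕ→F (p ℕ.* B ℕ.+ q ℕ.* D)
    combine p q A B C D = begin
      lit p * (ℕ→F A - ℕ→F B) + lit q * (ℕ→F C - ℕ→F D)
        ≈⟨ solve 6 (λ p q A B C D → p :* (A :- B) :+ q :* (C :- D) := (p :* A :+ q :* C) :- (p :* B :+ q :* D))
             refl (lit p) (lit q) (ℕ→F A) (ℕ→F B) (ℕ→F C) (ℕ→F D) ⟩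
      (lit p * ℕ→F A + lit q * ℕ→F C) - (lit p * ℕ→F B + lit q * ℕ→F D)
        ≈⟨ +-cong (trans (+-cong (lit*ℕ→F p A) (lit*ℕ→F q C)) (sym (ℕ→F-+ (p ℕ.* A) (q ℕ.* C))))
                  (-‿cong (trans (+-cong (lit*ℕ→F p B) (lit*ℕ→F q D)) (sym (ℕ→F-+ (p ℕ.* B) (q ℕ.* D))))) ⟩
      ℕ→F (p ℕ.* A ℕ.+ q ℕ.* C) - ℕ→F (p ℕ.* B ℕ.+ q ℕ.* D) ∎

  cosNum-suc : ∀ j → lit 3 * cosNum (residues j) - lit 4 * sinNum (residues j) ≈ cosNum (residues (suc j))
  cosNum-suc j with residues j
  ... | (a , b , c , d) = begin
    lit 3 * (ℕ→F A - ℕ→F B) - lit 4 * (ℕ→F C - ℕ→F D)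
      ≈⟨ solve 6 (λ p q A B C D → p :* (A :- B) :- q :* (C :- D) := p :* (A :- B) :+ q :* (D :- C))
           refl (lit 3) (lit 4) (ℕ→F A) (ℕ→F B) (ℕ→F C) (ℕ→F D) ⟩
    lit 3 * (ℕ→F A - ℕ→F B) + lit 4 * (ℕ→F D - ℕ→F C)    ≈⟨ combine 3 4 A B D C ⟩
    ℕ→F (3 ℕ.* A ℕ.+ 4 ℕ.* D) - ℕ→F (3 ℕ.* B ℕ.+ 4 ℕ.* C)
      ≈⟨ ℕ→F-difference (3 ℕ.* A ℕ.+ 4 ℕ.* D) (3 ℕ.* B ℕ.+ 4 ℕ.* C)
           (5 ℕ.* (3 ℕ.* a ℕ.+ 4 ℕ.* d) ℕ.+ 3) (5 ℕ.* (3 ℕ.* b ℕ.+ 4 ℕ.* c ℕ.+ 2)) (identity a b c d) ⟩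
    ℕ→F (5 ℕ.* (3 ℕ.* a ℕ.+ 4 ℕ.* d) ℕ.+ 3) - ℕ→F (5 ℕ.* (3 ℕ.* b ℕ.+ 4 ℕ.* c ℕ.+ 2)) ∎
    where
    A = 5 ℕ.* a ℕ.+ 3
    B = 5 ℕ.* b
    C = 5 ℕ.* c ℕ.+ 4
    D = 5 ℕ.* d
    identity : ∀ a b c d → (3 ℕ.* (5 ℕ.* a ℕ.+ 3) ℕ.+ 4 ℕ.* (5 ℕ.* d)) ℕ.+ 5 ℕ.* (3 ℕ.* b ℕ.+ 4 ℕ.* c ℕ.+ 2)
                         ≡ (5 ℕ.* (3 ℕ.* a ℕ.+ 4 ℕ.* d) ℕ.+ 3) ℕ.+ (3 ℕ.* (5 ℕ.* b) ℕ.+ 4 ℕ.* (5 ℕ.* c ℕ.+ 4))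
    identity = solve-∀

  sinNum-suc : ∀ j → lit 4 * cosNum (residues j) + lit 3 * sinNum (residues j) ≈ sinNum (residues (suc j))
  sinNum-suc j with residues j
  ... | (a , b , c , d) = trans (combine 4 3 A B C D)
    (ℕ→F-difference (4 ℕ.* A ℕ.+ 3 ℕ.* C) (4 ℕ.* B ℕ.+ 3 ℕ.* D)
                    (5 ℕ.* (4 ℕ.* a ℕ.+ 3 ℕ.* c ℕ.+ 4) ℕ.+ 4) (5 ℕ.* (4 ℕ.* b ℕ.+ 3 ℕ.* d)) (identity a b c d))
    where
    A = 5 ℕ.* a ℕ.+ 3
    B = 5 ℕ.* b
    C = 5 ℕ.* c ℕ.+ 4
    D = 5 ℕ.* d
    identity : ∀ a b c d → (4 ℕ.* (5 ℕ.* a ℕ.+ 3) ℕ.+ 3 ℕ.* (5 ℕ.* c ℕ.+ 4)) ℕ.+ 5 ℕ.* (4 ℕ.* b ℕ.+ 3 ℕ.* d)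
                         ≡ (5 ℕ.* (4 ℕ.* a ℕ.+ 3 ℕ.* c ℕ.+ 4) ℕ.+ 4) ℕ.+ (4 ℕ.* (5 ℕ.* b) ℕ.+ 3 ℕ.* (5 ℕ.* d))
    identity = solve-∀

  cosₙ×sinₙ-residues : ∀ j → (cosₙ cos₀ sin₀ (suc j) ≈ cosNum (residues j) * ((lit 5 ⁻¹) ^F suc j))
                           × (sinₙ cos₀ sin₀ (suc j) ≈ sinNum (residues j) * ((lit 5 ⁻¹) ^F suc j))
  cosₙ×sinₙ-residues zero =
    trans (solve 1 (λ i → (K 3 :* i) :* K 1 :- (K 4 :* i) :* K 0 := (K 3 :- K 0) :* (i :* K 1)) refl (lit 5 ⁻¹))
      (*-congʳ (+-cong (lit≈ℕ→F 3) (-‿cong (lit≈ℕ→F 0)))) ,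
    trans (solve 1 (λ i → (K 4 :* i) :* K 1 :+ (K 3 :* i) :* K 0 := (K 4 :- K 0) :* (i :* K 1)) refl (lit 5 ⁻¹))
      (*-congʳ (+-cong (lit≈ℕ→F 4) (-‿cong (lit≈ℕ→F 0))))
  cosₙ×sinₙ-residues (suc j) =
    trans (+-cong (*-congˡ (proj₁ IH)) (-‿cong (*-congˡ (proj₂ IH))))
      (trans (solve 6 (λ t f i C S I → (t :* i) :* (C :* I) :- (f :* i) :* (S :* I) := (t :* C :- f :* S) :* (i :* I))
                refl (lit 3) (lit 4) (lit 5 ⁻¹) (cosNum (residues j)) (sinNum (residues j)) ((lit 5 ⁻¹) ^F suc j))
             (*-congʳ (cosNum-suc j))) ,
    trans (+-cong (*-congˡ (proj₁ IH)) (*-congˡ (proj₂ IH)))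
      (trans (solve 6 (λ t f i C S I → (f :* i) :* (C :* I) :+ (t :* i) :* (S :* I) := (f :* C :+ t :* S) :* (i :* I))
                refl (lit 3) (lit 4) (lit 5 ⁻¹) (cosNum (residues j)) (sinNum (residues j)) ((lit 5 ⁻¹) ^F suc j))
             (*-congʳ (sinNum-suc j)))
    where IH = cosₙ×sinₙ-residues j

  cosₙ≉1 : ∀ j → ¬ (cosₙ cos₀ sin₀ (suc j) ≈ 1#)
  cosₙ≉1 j cos≈1 with residues j | proj₁ (cosₙ×sinₙ-residues j)
  ... | (a , b , c , d) | cos≈num = 5a+3≢5b+5c a (5 ℕ.^ j) b (ℕ→F-injective (begin
    ℕ→F (5 ℕ.* a ℕ.+ 3)
      ≈⟨ solve 2 (λ A B → A := (A :- B) :+ B) refl (ℕ→F (5 ℕ.* a ℕ.+ 3)) (ℕ→F (5 ℕ.* b)) ⟩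
    cosNum (a , b , c , d) + ℕ→F (5 ℕ.* b)          ≈⟨ +-congʳ num≈5ʲ⁺¹ ⟩
    ℕ→F (5 ℕ.^ suc j) + ℕ→F (5 ℕ.* b)               ≈⟨ sym (ℕ→F-+ (5 ℕ.^ suc j) (5 ℕ.* b)) ⟩
    ℕ→F (5 ℕ.* 5 ℕ.^ j ℕ.+ 5 ℕ.* b)                 ∎))
    where
    inv^*^≈1 : ∀ m → ((lit 5 ⁻¹) ^F m) * (lit 5 ^F m) ≈ 1#
    inv^*^≈1 zero    = *-identityˡ 1#
    inv^*^≈1 (suc m) = trans
      (solve 4 (λ i I f F → (i :* I) :* (f :* F) := (f :* i) :* (I :* F)) refl (lit 5 ⁻¹) ((lit 5 ⁻¹) ^F m) (lit 5) (lit 5 ^F m))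
      (trans (*-cong (⁻¹-inverseʳ _ 5≉0) (inv^*^≈1 m)) (*-identityˡ 1#))
    5^≈ℕ→F : ∀ m → lit 5 ^F m ≈ ℕ→F (5 ℕ.^ m)
    5^≈ℕ→F zero    = sym (+-identityʳ 1#)
    5^≈ℕ→F (suc m) = trans (*-cong (lit≈ℕ→F 5) (5^≈ℕ→F m)) (sym (ℕ→F-* 5 (5 ℕ.^ m)))
    num = cosNum (a , b , c , d)
    num≈5ʲ⁺¹ : num ≈ ℕ→F (5 ℕ.^ suc j)
    num≈5ʲ⁺¹ = begin
      num                                             ≈⟨ sym (*-identityʳ _) ⟩
      num * 1#                                        ≈⟨ *-congˡ (sym (inv^*^≈1 (suc j))) ⟩
      num * (((lit 5 ⁻¹) ^F suc j) * (lit 5 ^F suc j))  ≈⟨ sym (*-assoc _ _ _) ⟩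
      (num * ((lit 5 ⁻¹) ^F suc j)) * (lit 5 ^F suc j)  ≈⟨ *-congʳ (trans (sym cos≈num) cos≈1) ⟩
      1# * (lit 5 ^F suc j)                           ≈⟨ trans (*-identityˡ _) (5^≈ℕ→F (suc j)) ⟩
      ℕ→F (5 ℕ.^ suc j)                               ∎

  -- Invariance under the single rotation by arctan(4/3) already forces
  -- φ (P (j + 1)) = φ (Q (j + 1)) = 0, as that rotation has infinite order.
  circularIntegral⇒harmonicAverage : ∀ {φ} → IsCircularIntegral φ → IsHarmonicAverage φ
  circularIntegral⇒harmonicAverage {φ} isCI = record
    { localLinear = L
    ; φ-𝟏         = normalization
    ; φ-P         = λ j → proj₁ (harmonics≈0 j)
    ; φ-Q         = λ j → proj₂ (harmonics≈0 j)
    }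
    where
    open IsCircularIntegral isCI
    L : IsLocalLinear φ
    L = record { φ-++ = IsLinear.φ-+ linear ; φ-·ₚ = IsLinear.φ-scale linear ; φ-local = locality }
    ρ∈SO2 = rotation∈SO2 cos₀²+sin₀²≈1
    harmonics≈0 : ∀ j → (φ (P (suc j)) ≈ 0#) × (φ (Q (suc j)) ≈ 0#)
    harmonics≈0 j = rotation-fixedPoint≈0 2≉0 _ _ _ _
      (cosₙ²+sinₙ²≈1 cos₀ sin₀ cos₀²+sin₀²≈1 (suc j)) (cosₙ≉1 j)
      (trans (sym (invariance _ ρ∈SO2 (P (suc j)))) (SO2.φ-act-P ρ∈SO2 L (suc j)))
      (trans (sym (invariance _ ρ∈SO2 (Q (suc j)))) (SO2.φ-act-Q ρ∈SO2 L (suc j)))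

  ψ-invariant : ∀ h → InSO2 h → ∀ p → ψ (act h p) ≈ ψ p
  ψ-invariant h h∈SO2 = harmonicAverage-unique 2≉0 ψ∘h-isHarmonicAverage ψ-isHarmonicAverage
    where
    open IsHarmonicAverage ψ-isHarmonicAverage
    ψ∘h-isLocalLinear : IsLocalLinear (λ p → ψ (act h p))
    ψ∘h-isLocalLinear = record
      { φ-++    = λ p q → trans (reflexive (≡.cong ψ (subst-++ p q _ _))) (φ-++ (act h p) (act h q))
      ; φ-·ₚ    = λ a p → trans (reflexive (ψ≡extend (act h (a ·ₚ p))))
                            (trans (extend-subst-·ₚ ψ-mono a p _ _) (*-congˡ (sym (reflexive (ψ≡extend (act h p))))))
      ; φ-local = λ p p≈0 → φ-local (act h p) (λ x y on →
                    trans (ε-act h p x y) (p≈0 _ _ (SO2.preserves-S¹ h∈SO2 on)))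
      }
    ψ∘h-isHarmonicAverage : IsHarmonicAverage (λ p → ψ (act h p))
    ψ∘h-isHarmonicAverage = record
      { localLinear = ψ∘h-isLocalLinear
      ; φ-𝟏 = trans (φ-resp-≈on-S¹ {act h 𝟏} {𝟏} act-𝟏) φ-𝟏
      ; φ-P = λ j → trans (SO2.φ-act-P h∈SO2 localLinear (suc j)) (vanish (φ-P j) (φ-Q j))
      ; φ-Q = λ j → trans (SO2.φ-act-Q h∈SO2 localLinear (suc j)) (vanish (φ-P j) (φ-Q j))
      }
      where
      act-𝟏 : act h 𝟏 ≈on-S¹ 𝟏
      act-𝟏 x y _ = trans (ε-act h 𝟏 x y)
        (trans (ε-𝟏 (h i₁ i₁ * x + h i₂ i₁ * y) (h i₁ i₂ * x + h i₂ i₂ * y)) (sym (ε-𝟏 x y)))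
      vanish : ∀ {a b u v} → u ≈ 0# → v ≈ 0# → a * u + b * v ≈ 0#
      vanish {a} {b} u≈0 v≈0 = trans (+-cong (trans (*-congˡ u≈0) (zeroʳ a)) (trans (*-congˡ v≈0) (zeroʳ b))) (+-identityˡ 0#)

  ψ-isCircularIntegral : IsCircularIntegral ψ
  ψ-isCircularIntegral = record
    { linear        = record
      { φ-cong  = λ p q p≈q → trans (reflexive (ψ≡extend p))
                                (trans (extend-resp-≈ₚ ψ-mono {p} {q} p≈q) (sym (reflexive (ψ≡extend q))))
      ; φ-+     = φ-++
      ; φ-scale = φ-·ₚ
      }
    ; normalization = φ-𝟏
    ; locality      = φ-local
    ; invariance    = ψ-invariant
    }
    where open IsHarmonicAverage ψ-isHarmonicAverage

theorem3 : ∀ {c ℓ} (F : Field c ℓ) → WithField.CharZero F →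
    WithField.IsCircularIntegral F (WithField.ψ F)
    × (∀ (φ : WithField.Poly F → Field.Carrier F) →
         WithField.IsCircularIntegral F φ →
         ∀ p → Field._≈_ F (φ p) (WithField.ψ F p))
theorem3 F char0 =
  ψ-isCircularIntegral ,
  λ φ isCI → harmonicAverage-unique 2≉0 (circularIntegral⇒harmonicAverage isCI) ψ-isHarmonicAverage
  where open AnyField F
        open CharacteristicZero F char0
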